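{- Let $m$ be an integer such that $q=2m-3$ and $r=q+6=2m+3$ are both prime powers, and let $n=m^2$. Let $\chi$ denote the quadratic character on any finite field: $\chi(x)=1$ if $x$ is a nonzero square, $\chi(x)=-1$ if $x$ is a nonsquare, and $\chi(0)=0$. In the group $G=(GF(q),+)\oplus(GF(r),+)$, let $N=\{(0,0)\}$ and $$P=\{(x,y): \chi(x)\chi(y)=1\}\cup\{(0,y): y\neq 0\}.$$ Then $D=P-N$ is a $(4n-9,2n-1,n-1)$ signed difference set in $G$.
   Context: Let $G$ be a finite group of order $v$ and $\mathbb{Z}[G]$ its integral group ring; a subset $S\subseteq G$ is identified with $\sum_{g\in S} g\in\mathbb{Z}[G]$. A $(v,k,\lambda)$ signed difference set in $G$ is an element $D=\sum_{g\in G}s_g g$ with all $s_g\in\{ -1,0,1\}$ such that, with $P=\{g:s_g=1\}$, $N=\{g:s_g=-1\}$ and $k=\lvert P\rvert+\lvert N\rvert$, one has $DD^{(-1)}=(k-\lambda)\cdot 1_G+\lambda\sum_{g\in G}g$, where $D^{(-1)}=\sum_g s_g g^{ -1}$. -}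

module Defs where

open import Level using (0ℓ)
open import Data.Nat as ℕ using (ℕ)
open import Data.Nat.Primality using (Prime)
open import Data.Integer as ℤ using (ℤ; +_; 0ℤ; 1ℤ; -1ℤ)
open import Data.Fin using (Fin; zero; suc)
open import Data.Fin.Properties as FinP using (any?; *↔×)
open import Data.Product using (Σ; ∃; _×_; _,_; proj₁; proj₂)
open import Data.Product.Properties using (≡-dec)
open import Function using (_∘_)
open import Function.Bundles using (_↔_; Inverse)
open import Function.Construct.Composition using () renaming (inverse to _∘↔_)
open import Relation.Nullary using (Dec; yes; no; ¬_)
open import Relation.Binary.PropositionalEquality
open import Algebra.Core using (Op₁; Op₂)
import Algebra.Structures as AS

IsPrimePower : ℕ → Set
IsPrimePower n = Σ ℕ λ p → Σ ℕ λ e → Prime p × (1 ℕ.≤ e) × (n ≡ p ℕ.^ e)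

sumFin : (v : ℕ) → (Fin v → ℤ) → ℤ
sumFin ℕ.zero    f = 0ℤ
sumFin (ℕ.suc v) f = f zero ℤ.+ sumFin v (f ∘ suc)

record FiniteGroup : Set₁ where
  field
    Carrier : Set
    _∙_     : Op₂ Carrier
    ε       : Carrier
    _⁻¹     : Op₁ Carrier
    isGroup : AS.IsGroup {A = Carrier} _≡_ _∙_ ε _⁻¹
    order   : ℕ
    enum    : Fin order ↔ Carrier

  elt : Fin order → Carrier
  elt = Inverse.to enum

  _≟_ : (x y : Carrier) → Dec (x ≡ y)
  x ≟ y with Inverse.from enum x FinP.≟ Inverse.from enum y
  ... | yes e = yes (trans (sym (Inverse.strictlyInverseˡ enum x))
                     (trans (cong (Inverse.to enum) e) (Inverse.strictlyInverseˡ enum y)))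
  ... | no ne = no (λ e → ne (cong (Inverse.from enum) e))

  ΣG : (Carrier → ℤ) → ℤ
  ΣG f = sumFin order (f ∘ elt)

module GroupRing (G : FiniteGroup) where
  open FiniteGroup G

  ℤ[G] : Set
  ℤ[G] = Carrier → ℤ

  _·_ : ℤ[G] → ℤ[G] → ℤ[G]
  (X · Y) g = ΣG (λ h → X h ℤ.* Y ((h ⁻¹) ∙ g))

  -- D^{(-1)} = Σ_g s_g g⁻¹, i.e. coefficient at g is s_{g⁻¹}
  _⁽⁻¹⁾ : ℤ[G] → ℤ[G]
  (X ⁽⁻¹⁾) g = X (g ⁻¹)

  one : ℤ[G]
  one g with g ≟ ε
  ... | yes _ = 1ℤ
  ... | no  _ = 0ℤ

  all : ℤ[G]
  all g = 1ℤ

  _⊕_ : ℤ[G] → ℤ[G] → ℤ[G]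
  (X ⊕ Y) g = X g ℤ.+ Y g

  _⊛_ : ℤ → ℤ[G] → ℤ[G]
  (c ⊛ X) g = c ℤ.* X g

  ind : {S : Carrier → Set} → ((g : Carrier) → Dec (S g)) → ℤ[G]
  ind S? g with S? g
  ... | yes _ = 1ℤ
  ... | no  _ = 0ℤ

  card : {S : Carrier → Set} → ((g : Carrier) → Dec (S g)) → ℤ
  card S? = ΣG (ind S?)

  IsSignedDifferenceSet : ℤ → ℤ → ℤ → ℤ[G] → Set
  IsSignedDifferenceSet v k lam D =
      (+ order ≡ v)
    × (∀ g → (D g ≡ 1ℤ) ⊎' ((D g ≡ 0ℤ) ⊎' (D g ≡ -1ℤ)))
    × (k ≡ card (λ g → D g ℤ.≟ 1ℤ) ℤ.+ card (λ g → D g ℤ.≟ -1ℤ))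
    × (∀ g → (D · (D ⁽⁻¹⁾)) g ≡ (((k ℤ.- lam) ⊛ one) ⊕ (lam ⊛ all)) g)
    where
    open import Data.Sum using () renaming (_⊎_ to _⊎'_)

record FiniteField (q : ℕ) : Set₁ where
  field
    Carrier : Set
    _+_ _*_ : Op₂ Carrier
    -_      : Op₁ Carrier
    0# 1#   : Carrier
    isCommutativeRing : AS.IsCommutativeRing {A = Carrier} _≡_ _+_ _*_ -_ 0# 1#
    0≢1     : ¬ (0# ≡ 1#)
    inv     : ∀ x → ¬ (x ≡ 0#) → Σ Carrier λ y → x * y ≡ 1#
    enum    : Fin q ↔ Carrier

  elt : Fin q → Carrier
  elt = Inverse.to enum

  _≟_ : (x y : Carrier) → Dec (x ≡ y)
  x ≟ y with Inverse.from enum x FinP.≟ Inverse.from enum y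
  ... | yes e = yes (trans (sym (Inverse.strictlyInverseˡ enum x))
                     (trans (cong (Inverse.to enum) e) (Inverse.strictlyInverseˡ enum y)))
  ... | no ne = no (λ e → ne (cong (Inverse.from enum) e))

  IsSquare : Carrier → Set
  IsSquare x = Σ Carrier λ y → y * y ≡ x

  isSquare? : (x : Carrier) → Dec (IsSquare x)
  isSquare? x with any? (λ i → (elt i * elt i) ≟ x)
  ... | yes (i , e) = yes (elt i , e)
  ... | no ne = no (λ { (y , e) → ne (Inverse.from enum y ,
          trans (cong (λ z → z * z) (Inverse.strictlyInverseˡ enum y)) e) })

  χ : Carrier → ℤ
  χ x with x ≟ 0#
  ... | yes _ = 0ℤ
  ... | no  _ with isSquare? x
  ...   | yes _ = 1ℤ
  ...   | no  _ = -1ℤ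

  open AS.IsCommutativeRing isCommutativeRing public
    using () renaming (+-isAbelianGroup to +-isAbelianGroup)

module _ {q r : ℕ} (F : FiniteField q) (K : FiniteField r) where
  private
    module F = FiniteField F
    module K = FiniteField K
    module FG = AS.IsAbelianGroup F.+-isAbelianGroup
    module KG = AS.IsAbelianGroup K.+-isAbelianGroup

  ⊕-isGroup : AS.IsGroup {A = F.Carrier × K.Carrier} _≡_
                (λ a b → (proj₁ a F.+ proj₁ b) , (proj₂ a K.+ proj₂ b))
                (F.0# , K.0#)
                (λ a → (F.- proj₁ a) , (K.- proj₂ a))
  ⊕-isGroup = record
    { isMonoid = record
      { isSemigroup = record
        { isMagma = record
          { isEquivalence = isEquivalence
          ; ∙-cong = λ e₁ e₂ → cong₂ (λ a b → (proj₁ a F.+ proj₁ b) , (proj₂ a K.+ proj₂ b)) e₁ e₂ }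
        ; assoc = λ x y z → cong₂ _,_ (FG.assoc (proj₁ x) (proj₁ y) (proj₁ z))
                                      (KG.assoc (proj₂ x) (proj₂ y) (proj₂ z)) }
      ; identity = (λ x → cong₂ _,_ (proj₁ FG.identity (proj₁ x)) (proj₁ KG.identity (proj₂ x)))
                 , (λ x → cong₂ _,_ (proj₂ FG.identity (proj₁ x)) (proj₂ KG.identity (proj₂ x))) }
    ; inverse = (λ x → cong₂ _,_ (proj₁ FG.inverse (proj₁ x)) (proj₁ KG.inverse (proj₂ x)))
              , (λ x → cong₂ _,_ (proj₂ FG.inverse (proj₁ x)) (proj₂ KG.inverse (proj₂ x)))
    ; ⁻¹-cong = cong (λ a → (F.- proj₁ a) , (K.- proj₂ a)) }

  AddGroup⊕ : FiniteGroup
  AddGroup⊕ = record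
    { Carrier = F.Carrier × K.Carrier
    ; _∙_ = λ a b → (proj₁ a F.+ proj₁ b) , (proj₂ a K.+ proj₂ b)
    ; ε = F.0# , K.0#
    ; _⁻¹ = λ a → (F.- proj₁ a) , (K.- proj₂ a)
    ; isGroup = ⊕-isGroup
    ; order = q ℕ.* r
    ; enum = *↔× {q} {r} ∘↔ pairEnum }
    where
    open import Data.Product.Function.NonDependent.Propositional using (_×-↔_)
    pairEnum : (Fin q × Fin r) ↔ (F.Carrier × K.Carrier)
    pairEnum = F.enum ×-↔ K.enum

  InP : F.Carrier × K.Carrier → Set
  InP (x , y) = (F.χ x ℤ.* K.χ y ≡ 1ℤ) ⊎ ((x ≡ F.0#) × ¬ (y ≡ K.0#))
    where open import Data.Sum using (_⊎_)

  InN : F.Carrier × K.Carrier → Set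
  InN g = g ≡ (F.0# , K.0#)

  InP? : (g : F.Carrier × K.Carrier) → Dec (InP g)
  InP? (x , y) = (F.χ x ℤ.* K.χ y ℤ.≟ 1ℤ) ⊎-dec ((x F.≟ F.0#) ×-dec ¬? (y K.≟ K.0#))
    where open import Relation.Nullary.Decidable using (_⊎-dec_; _×-dec_; ¬?)

  InN? : (g : F.Carrier × K.Carrier) → Dec (InN g)
  InN? g = ≡-dec F._≟_ K._≟_ g (F.0# , K.0#)

  D-PN : F.Carrier × K.Carrier → ℤ
  D-PN g = GroupRing.ind AddGroup⊕ InP? g ℤ.- GroupRing.ind AddGroup⊕ InN? g

{-# OPTIONS --safe #-}

-- Write χ for the quadratic characters and δ for the indicator of 0. Pointwise
-- 2D = χ ⊗ χ + 1 ⊗ (1 - δ) + δ ⊗ (1 - 3δ), so 4 D D⁽⁻¹⁾ is a sum of products of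
-- correlations Σₓ f(x) g(x - a) on the two factors, with f, g ∈ {χ, 1, δ}. Besides trivial
-- ones they come from Σ χ = 0, χ(-x) = χ(-1) χ(x) and the Jacobi sum Σₓ χ(x) χ(x - a) = -1
-- for a ≠ 0. The terms in χ_F(a) χ_K(b) carry the factor 1 + χ_F(-1) χ_K(-1), which vanishes
-- because χ(-1) = (-1)^((q-1)/2) and (q - 1)/2, (r - 1)/2 differ by 3.
module Submission where

open import Defs
open import Data.Nat as ℕ using (ℕ; zero; suc)
import Data.Nat.Properties as ℕP
open import Data.Integer as ℤ using (ℤ; +_; 0ℤ; 1ℤ; -1ℤ)
import Data.Integer.Properties as ℤP
open import Data.Integer.Tactic.RingSolver using (solve-∀; solve)
open import Data.List using (_∷_; [])
open import Data.Fin using (Fin; zero; suc; _↑ˡ_; _↑ʳ_; combine; remQuot)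
import Data.Fin.Properties as FinP
open import Data.Fin.Properties using (_<?_)
open import Data.Product using (∃; _×_; _,_; proj₁; proj₂)
open import Data.Sum using (_⊎_; inj₁; inj₂; [_,_]′)
open import Data.Empty using (⊥-elim)
open import Function using (_∘_)
open import Function.Bundles using (_↔_; Inverse; mk↔ₛ′)
open import Function.Construct.Composition using (_↔-∘_)
open import Function.Construct.Symmetry using (↔-sym)
open import Relation.Nullary using (Dec; yes; no; ¬_)
open import Relation.Binary.Definitions using (tri<; tri≈; tri>)
open import Relation.Binary.PropositionalEquality
import Algebra.Solver.CommutativeMonoid

module Parity where

  open import Data.Integer using (_+_; _-_)
  open ≡-Reasoning

  Even : ℤ → Set
  Even i = ∃ λ k → i ≡ k + k

  Odd : ℤ → Set
  Odd i = ∃ λ k → i ≡ 1ℤ + (k + k)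

  even⇒¬odd : ∀ {i} → Even i → ¬ Odd i
  even⇒¬odd {i} (k , i≡k+k) (l , i≡1+l+l) = 1≢j+j {k - l} (begin
    1ℤ                        ≡⟨ solve (l ∷ []) ⟩
    (1ℤ + (l + l)) - (l + l)  ≡⟨ cong (_- (l + l)) (trans (sym i≡1+l+l) i≡k+k) ⟩
    (k + k) - (l + l)         ≡⟨ solve (k ∷ l ∷ []) ⟩
    (k - l) + (k - l)         ∎)
    where
    1≢j+j : ∀ {j} → 1ℤ ≢ j + j
    1≢j+j {+ n} e = ℕP.even≢odd n 0 (sym (trans (ℤP.+-injective e) (cong (n ℕ.+_) (sym (ℕP.+-identityʳ n)))))
    1≢j+j {ℤ.-[1+ n ]} ()

  even+3 : ∀ {i} → Even i → Odd (i + + 3)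
  even+3 {i} (k , i≡k+k) = k + 1ℤ , trans (cong (_+ + 3) i≡k+k) (shift k)
    where
    shift : ∀ k → (k + k) + + 3 ≡ 1ℤ + ((k + 1ℤ) + (k + 1ℤ))
    shift = solve-∀

  odd+3 : ∀ {i} → Odd i → Even (i + + 3)
  odd+3 {i} (k , i≡1+k+k) = k + + 2 , trans (cong (_+ + 3) i≡1+k+k) (shift k)
    where
    shift : ∀ k → (1ℤ + (k + k)) + + 3 ≡ (k + + 2) + (k + + 2)
    shift = solve-∀

open Parity

module FiniteSums where

  open import Data.Integer using (_+_; _*_; -_; _-_; _≤_)
  import Algebra.Properties.Semiring.Sum ℤP.+-*-semiring as ℤΣ
  open ≡-Reasoning

  ⟦_⟧ : {P : Set} → Dec P → ℤ
  ⟦ yes _ ⟧ = 1ℤ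
  ⟦ no _ ⟧ = 0ℤ

  ⟦⟧-yes : {P : Set} → P → (d : Dec P) → ⟦ d ⟧ ≡ 1ℤ
  ⟦⟧-yes p (yes _) = refl
  ⟦⟧-yes p (no ¬p) = ⊥-elim (¬p p)

  ⟦⟧-no : {P : Set} → ¬ P → (d : Dec P) → ⟦ d ⟧ ≡ 0ℤ
  ⟦⟧-no ¬p (yes p) = ⊥-elim (¬p p)
  ⟦⟧-no ¬p (no _) = refl

  ⟦⟧-cong : {P Q : Set} → (P → Q) → (Q → P) → (d : Dec P) (e : Dec Q) → ⟦ d ⟧ ≡ ⟦ e ⟧
  ⟦⟧-cong f g (yes p) e = sym (⟦⟧-yes (f p) e)
  ⟦⟧-cong f g (no ¬p) e = sym (⟦⟧-no (¬p ∘ g) e)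

  sumFin≡sum : ∀ n (f : Fin n → ℤ) → sumFin n f ≡ ℤΣ.sum f
  sumFin≡sum zero    f = refl
  sumFin≡sum (suc n) f = cong (_+_ (f zero)) (sumFin≡sum n (f ∘ suc))

  module _ {n : ℕ} where

    sumFin-cong : ∀ {f g : Fin n → ℤ} → (∀ i → f i ≡ g i) → sumFin n f ≡ sumFin n g
    sumFin-cong {f} {g} f≗g = begin
      sumFin n f    ≡⟨ sumFin≡sum n f ⟩
      ℤΣ.sum f      ≡⟨ ℤΣ.sum-cong-≗ f≗g ⟩
      ℤΣ.sum g      ≡⟨ sumFin≡sum n g ⟨
      sumFin n g    ∎

    sumFin-+ : ∀ (f g : Fin n → ℤ) → sumFin n (λ i → f i + g i) ≡ sumFin n f + sumFin n g
    sumFin-+ f g = begin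
      sumFin n (λ i → f i + g i)   ≡⟨ sumFin≡sum n _ ⟩
      ℤΣ.sum (λ i → f i + g i)     ≡⟨ ℤΣ.∑-distrib-+ f g ⟩
      ℤΣ.sum f + ℤΣ.sum g          ≡⟨ cong₂ _+_ (sumFin≡sum n f) (sumFin≡sum n g) ⟨
      sumFin n f + sumFin n g      ∎

    sumFin-*ˡ : ∀ c (f : Fin n → ℤ) → sumFin n (λ i → c * f i) ≡ c * sumFin n f
    sumFin-*ˡ c f = begin
      sumFin n (λ i → c * f i)     ≡⟨ sumFin≡sum n _ ⟩
      ℤΣ.sum (λ i → c * f i)       ≡⟨ ℤΣ.*-distribˡ-sum c f ⟨
      c * ℤΣ.sum f                 ≡⟨ cong (c *_) (sumFin≡sum n f) ⟨
      c * sumFin n f               ∎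

    sumFin-permute : ∀ (f : Fin n → ℤ) (π : Fin n ↔ Fin n) → sumFin n (f ∘ Inverse.to π) ≡ sumFin n f
    sumFin-permute f π = begin
      sumFin n (f ∘ Inverse.to π)  ≡⟨ sumFin≡sum n _ ⟩
      ℤΣ.sum (f ∘ Inverse.to π)    ≡⟨ ℤΣ.sum-permute f π ⟨
      ℤΣ.sum f                     ≡⟨ sumFin≡sum n f ⟨
      sumFin n f                   ∎

  sumFin-comm : ∀ m n (f : Fin m → Fin n → ℤ) →
                sumFin m (λ i → sumFin n (f i)) ≡ sumFin n (λ j → sumFin m (λ i → f i j))
  sumFin-comm m n f = begin
    sumFin m (λ i → sumFin n (f i))                 ≡⟨ sumFin-cong (λ i → sumFin≡sum n (f i)) ⟩
    sumFin m (λ i → ℤΣ.sum (f i))                   ≡⟨ sumFin≡sum m _ ⟩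
    ℤΣ.sum (λ i → ℤΣ.sum (f i))                     ≡⟨ ℤΣ.∑-comm f ⟩
    ℤΣ.sum (λ j → ℤΣ.sum (λ i → f i j))             ≡⟨ sumFin≡sum n _ ⟨
    sumFin n (λ j → ℤΣ.sum (λ i → f i j))           ≡⟨ sumFin-cong (λ j → sumFin≡sum m (λ i → f i j)) ⟨
    sumFin n (λ j → sumFin m (λ i → f i j))         ∎

  sumFin-const : ∀ n c → sumFin n (λ _ → c) ≡ + n * c
  sumFin-const zero    c = refl
  sumFin-const (suc n) c = begin
    c + sumFin n (λ _ → c)   ≡⟨ cong (_+_ c) (sumFin-const n c) ⟩
    c + + n * c              ≡⟨ cong (_+ + n * c) (ℤP.*-identityˡ c) ⟨
    1ℤ * c + + n * c         ≡⟨ ℤP.*-distribʳ-+ c 1ℤ (+ n) ⟨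
    + suc n * c              ∎

  sumFin-indicator : ∀ n (j : Fin n) → sumFin n (λ i → ⟦ i FinP.≟ j ⟧) ≡ 1ℤ
  sumFin-indicator (suc n) zero    = cong (_+_ 1ℤ) (trans (sumFin-const n 0ℤ) (ℤP.*-zeroʳ (+ n)))
  sumFin-indicator (suc n) (suc j) =
    trans (ℤP.+-identityˡ _) (trans (sumFin-cong pointwise) (sumFin-indicator n j))
    where
    pointwise : ∀ i → ⟦ suc i FinP.≟ suc j ⟧ ≡ ⟦ i FinP.≟ j ⟧
    pointwise i = ⟦⟧-cong FinP.suc-injective (cong suc) (suc i FinP.≟ suc j) (i FinP.≟ j)

  sumFin-↑ : ∀ m n (f : Fin (m ℕ.+ n) → ℤ) →
             sumFin (m ℕ.+ n) f ≡ sumFin m (λ i → f (i ↑ˡ n)) + sumFin n (λ j → f (m ↑ʳ j))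
  sumFin-↑ zero    n f = sym (ℤP.+-identityˡ _)
  sumFin-↑ (suc m) n f = trans (cong (_+_ (f zero)) (sumFin-↑ m n (f ∘ suc))) (sym (ℤP.+-assoc (f zero) _ _))

  sumFin-combine : ∀ m n (f : Fin (m ℕ.* n) → ℤ) →
                   sumFin (m ℕ.* n) f ≡ sumFin m (λ i → sumFin n (λ j → f (combine i j)))
  sumFin-combine zero    n f = refl
  sumFin-combine (suc m) n f =
    trans (sumFin-↑ n (m ℕ.* n) f) (cong (_+_ (sumFin n (λ j → f (j ↑ˡ m ℕ.* n)))) (sumFin-combine m n (λ k → f (n ↑ʳ k))))

  sumFin-remQuot : ∀ m n (f : Fin m × Fin n → ℤ) →
                   sumFin (m ℕ.* n) (f ∘ remQuot n) ≡ sumFin m (λ i → sumFin n (λ j → f (i , j)))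
  sumFin-remQuot m n f = trans (sumFin-combine m n (f ∘ remQuot n))
    (sumFin-cong (λ i → sumFin-cong (λ j → cong f (FinP.remQuot-combine i j))))

  sumFin-nonpos : ∀ n (f : Fin n → ℤ) → (∀ i → f i ≤ 0ℤ) → sumFin n f ≡ 0ℤ → ∀ i → f i ≡ 0ℤ
  sumFin-nonpos (suc n) f f≤0 Σf≡0 = λ
    { zero    → head≡0
    ; (suc i) → sumFin-nonpos n (f ∘ suc) (f≤0 ∘ suc) tail≡0 i }
    where
    tail≤0 : ∀ m (g : Fin m → ℤ) → (∀ i → g i ≤ 0ℤ) → sumFin m g ≤ 0ℤ
    tail≤0 zero    g g≤0 = ℤP.≤-refl
    tail≤0 (suc m) g g≤0 = ℤP.+-mono-≤ (g≤0 zero) (tail≤0 m (g ∘ suc) (g≤0 ∘ suc))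
    head≡0 : f zero ≡ 0ℤ
    head≡0 = ℤP.≤-antisym (f≤0 zero)
      (subst₂ _≤_ Σf≡0 (ℤP.+-identityʳ (f zero)) (ℤP.+-monoʳ-≤ (f zero) (tail≤0 n (f ∘ suc) (f≤0 ∘ suc))))
    tail≡0 : sumFin n (f ∘ suc) ≡ 0ℤ
    tail≡0 = trans (sym (ℤP.+-identityˡ _)) (trans (cong (_+ sumFin n (f ∘ suc)) (sym head≡0)) Σf≡0)

  sumFin-*-sumFin : ∀ m n (u : Fin m → ℤ) (v : Fin n → ℤ) →
                    sumFin m u * sumFin n v ≡ sumFin m (λ i → sumFin n (λ j → u i * v j))
  sumFin-*-sumFin m n u v = begin
    sumFin m u * sumFin n v                       ≡⟨ ℤP.*-comm (sumFin m u) _ ⟩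
    sumFin n v * sumFin m u                       ≡⟨ sumFin-*ˡ (sumFin n v) u ⟨
    sumFin m (λ i → sumFin n v * u i)             ≡⟨ sumFin-cong (λ i → ℤP.*-comm (sumFin n v) (u i)) ⟩
    sumFin m (λ i → u i * sumFin n v)             ≡⟨ sumFin-cong (λ i → sumFin-*ˡ (u i) v) ⟨
    sumFin m (λ i → sumFin n (λ j → u i * v j))   ∎

  module Enumerated {A : Set} {n : ℕ} (enum : Fin n ↔ A) where

    elt : Fin n → A
    elt = Inverse.to enum

    index : A → Fin n
    index = Inverse.from enum

    elt-index : ∀ x → elt (index x) ≡ x
    elt-index = Inverse.strictlyInverseˡ enum

    index-elt : ∀ i → index (elt i) ≡ i
    index-elt = Inverse.strictlyInverseʳ enum

    index-injective : ∀ {x y} → index x ≡ index y → x ≡ y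
    index-injective {x} {y} e = trans (sym (elt-index x)) (trans (cong elt e) (elt-index y))

    Σ : (A → ℤ) → ℤ
    Σ f = sumFin n (f ∘ elt)

    Σ-cong : ∀ {f g : A → ℤ} → (∀ x → f x ≡ g x) → Σ f ≡ Σ g
    Σ-cong f≗g = sumFin-cong (f≗g ∘ elt)

    Σ-+ : ∀ (f g : A → ℤ) → Σ (λ x → f x + g x) ≡ Σ f + Σ g
    Σ-+ f g = sumFin-+ (f ∘ elt) (g ∘ elt)

    Σ-*ˡ : ∀ c (f : A → ℤ) → Σ (λ x → c * f x) ≡ c * Σ f
    Σ-*ˡ c f = sumFin-*ˡ c (f ∘ elt)

    Σ-*ʳ : ∀ (f : A → ℤ) c → Σ (λ x → f x * c) ≡ Σ f * c
    Σ-*ʳ f c = trans (Σ-cong (λ x → ℤP.*-comm (f x) c)) (trans (Σ-*ˡ c f) (ℤP.*-comm c (Σ f)))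

    Σ-neg : ∀ (f : A → ℤ) → Σ (λ x → - f x) ≡ - Σ f
    Σ-neg f = begin
      Σ (λ x → - f x)        ≡⟨ Σ-cong (λ x → ℤP.-1*i≡-i (f x)) ⟨
      Σ (λ x → -1ℤ * f x)    ≡⟨ Σ-*ˡ -1ℤ f ⟩
      -1ℤ * Σ f              ≡⟨ ℤP.-1*i≡-i (Σ f) ⟩
      - Σ f                  ∎

    Σ-sub : ∀ (f g : A → ℤ) → Σ (λ x → f x - g x) ≡ Σ f - Σ g
    Σ-sub f g = trans (Σ-+ f (λ x → - g x)) (cong (_+_ (Σ f)) (Σ-neg g))

    Σ-const : ∀ c → Σ (λ _ → c) ≡ + n * c
    Σ-const = sumFin-const n

    Σ-0 : Σ (λ _ → 0ℤ) ≡ 0ℤ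
    Σ-0 = trans (Σ-const 0ℤ) (ℤP.*-zeroʳ (+ n))

    Σ-1 : Σ (λ _ → 1ℤ) ≡ + n
    Σ-1 = trans (Σ-const 1ℤ) (ℤP.*-identityʳ (+ n))

    Σ-sumFin : ∀ m (f : Fin m → A → ℤ) → Σ (λ x → sumFin m (λ i → f i x)) ≡ sumFin m (λ i → Σ (f i))
    Σ-sumFin m f = sumFin-comm n m (λ k i → f i (elt k))

    Σ-comm : ∀ (f : A → A → ℤ) → Σ (λ x → Σ (f x)) ≡ Σ (λ y → Σ (λ x → f x y))
    Σ-comm f = sumFin-comm n n (λ i j → f (elt i) (elt j))

    Σ-indicator : ∀ a (≟a : ∀ x → Dec (x ≡ a)) → Σ (λ x → ⟦ ≟a x ⟧) ≡ 1ℤ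
    Σ-indicator a ≟a = trans (sumFin-cong pointwise) (sumFin-indicator n (index a))
      where
      pointwise : ∀ i → ⟦ ≟a (elt i) ⟧ ≡ ⟦ i FinP.≟ index a ⟧
      pointwise i = ⟦⟧-cong (λ e → trans (sym (index-elt i)) (cong index e))
                            (λ e → trans (cong elt e) (elt-index a)) (≟a (elt i)) (i FinP.≟ index a)

    Σ-select : ∀ (f : A → ℤ) a (≟a : ∀ x → Dec (x ≡ a)) → Σ (λ x → f x * ⟦ ≟a x ⟧) ≡ f a
    Σ-select f a ≟a = begin
      Σ (λ x → f x * ⟦ ≟a x ⟧)   ≡⟨ Σ-cong pointwise ⟩
      Σ (λ x → f a * ⟦ ≟a x ⟧)   ≡⟨ Σ-*ˡ (f a) (λ x → ⟦ ≟a x ⟧) ⟩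
      f a * Σ (λ x → ⟦ ≟a x ⟧)   ≡⟨ cong (f a *_) (Σ-indicator a ≟a) ⟩
      f a * 1ℤ                   ≡⟨ ℤP.*-identityʳ (f a) ⟩
      f a                        ∎
      where
      pointwise : ∀ x → f x * ⟦ ≟a x ⟧ ≡ f a * ⟦ ≟a x ⟧
      pointwise x with ≟a x
      ... | yes refl = refl
      ... | no _     = trans (ℤP.*-zeroʳ (f x)) (sym (ℤP.*-zeroʳ (f a)))

    Σ-bijection : ∀ (σ : A ↔ A) (f : A → ℤ) → Σ (f ∘ Inverse.to σ) ≡ Σ f
    Σ-bijection σ f = begin
      sumFin n (f ∘ Inverse.to σ ∘ elt)            ≡⟨ sumFin-cong (λ i → cong f (elt-index (Inverse.to σ (elt i)))) ⟨
      sumFin n (f ∘ elt ∘ Inverse.to π)            ≡⟨ sumFin-permute (f ∘ elt) π ⟩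
      sumFin n (f ∘ elt)                           ∎
      where
      π : Fin n ↔ Fin n
      π = ↔-sym enum ↔-∘ (σ ↔-∘ enum)

    Σ-nonpos : ∀ (f : A → ℤ) → (∀ x → f x ≤ 0ℤ) → Σ f ≡ 0ℤ → ∀ x → f x ≡ 0ℤ
    Σ-nonpos f f≤0 Σf≡0 x =
      trans (cong f (sym (elt-index x))) (sumFin-nonpos n (f ∘ elt) (f≤0 ∘ elt) Σf≡0 (index x))

    -- Off the fixed points, σ pairs x with σ x; count each pair at the element of smaller index.
    Σ-involution : ∀ (σ : A → A) → (∀ x → σ (σ x) ≡ x) → (fixed? : ∀ x → Dec (σ x ≡ x)) →
                   ∀ (f : A → ℤ) → (∀ x → f (σ x) ≡ f x) →
                   ∃ λ k → Σ f ≡ Σ (λ x → ⟦ fixed? x ⟧ * f x) + (k + k)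
    Σ-involution σ σσ fixed? f fσ = Σ below , (begin
      Σ f                                                ≡⟨ Σ-cong split ⟩
      Σ (λ x → fixed x + (below x + above x))            ≡⟨ Σ-+ fixed (λ x → below x + above x) ⟩
      Σ fixed + Σ (λ x → below x + above x)              ≡⟨ cong (_+_ (Σ fixed)) (Σ-+ below above) ⟩
      Σ fixed + (Σ below + Σ above)                      ≡⟨ cong (λ s → Σ fixed + (Σ below + s)) Σabove≡Σbelow ⟩
      Σ fixed + (Σ below + Σ below)                      ∎)
      where
      fixed below above : A → ℤ
      fixed x = ⟦ fixed? x ⟧ * f x
      below x = ⟦ index x <? index (σ x) ⟧ * f x
      above x = ⟦ index (σ x) <? index x ⟧ * f x

      σ↔ : A ↔ A
      σ↔ = mk↔ₛ′ σ σ σσ σσ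

      Σabove≡Σbelow : Σ above ≡ Σ below
      Σabove≡Σbelow = trans (Σ-cong (λ x → sym (cong₂ (λ y v → ⟦ index (σ x) <? index y ⟧ * v) (σσ x) (fσ x))))
                            (Σ-bijection σ↔ below)

      one-of-three : ∀ x → ⟦ fixed? x ⟧ + (⟦ index x <? index (σ x) ⟧ + ⟦ index (σ x) <? index x ⟧) ≡ 1ℤ
      one-of-three x with FinP.<-cmp (index x) (index (σ x))
      ... | tri< i<j i≢j j≮i rewrite ⟦⟧-no (i≢j ∘ cong index ∘ sym) (fixed? x)
                                   | ⟦⟧-yes i<j (index x <? index (σ x)) | ⟦⟧-no j≮i (index (σ x) <? index x) = refl
      ... | tri≈ i≮j i≡j j≮i rewrite ⟦⟧-yes (index-injective (sym i≡j)) (fixed? x)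
                                   | ⟦⟧-no i≮j (index x <? index (σ x)) | ⟦⟧-no j≮i (index (σ x) <? index x) = refl
      ... | tri> i≮j i≢j j<i rewrite ⟦⟧-no (i≢j ∘ cong index ∘ sym) (fixed? x)
                                   | ⟦⟧-no i≮j (index x <? index (σ x)) | ⟦⟧-yes j<i (index (σ x) <? index x) = refl

      split : ∀ x → f x ≡ fixed x + (below x + above x)
      split x = begin
        f x                                 ≡⟨ ℤP.*-identityˡ (f x) ⟨
        1ℤ * f x                            ≡⟨ cong (_* f x) (one-of-three x) ⟨
        (a + (b + c)) * f x                 ≡⟨ distribute a b c (f x) ⟩
        a * f x + (b * f x + c * f x)       ∎
        where
        a = ⟦ fixed? x ⟧
        b = ⟦ index x <? index (σ x) ⟧
        c = ⟦ index (σ x) <? index x ⟧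
        distribute : ∀ a b c v → (a + (b + c)) * v ≡ a * v + (b * v + c * v)
        distribute = solve-∀

open FiniteSums

module FiniteFieldProperties {q : ℕ} (F : FiniteField q) where

  open import Data.Integer using () renaming (_+_ to _+ℤ_; _*_ to _*ℤ_; _-_ to _-ℤ_)
  open import Algebra.Bundles using (CommutativeRing)
  open ≡-Reasoning

  open FiniteField F public using (Carrier; _≟_; IsSquare; isSquare?; χ)
  open Enumerated (FiniteField.enum F) public

  ring : CommutativeRing _ _
  ring = record { isCommutativeRing = FiniteField.isCommutativeRing F }

  open CommutativeRing ring public using (_+_; _*_; -_; 0#; 1#)
  open CommutativeRing ring using
    ( +-assoc; +-comm; +-identityˡ; +-identityʳ; -‿inverseˡ; -‿inverseʳ
    ; *-assoc; *-comm; *-identityˡ; *-identityʳ; distribˡ; distribʳ; zeroʳ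
    ; +-group; +-commutativeMonoid; *-commutativeMonoid )
  open import Algebra.Properties.Ring (CommutativeRing.ring ring) using (-‿distribˡ-*; -‿distribʳ-*)
  open import Algebra.Properties.Group +-group using (ε⁻¹≈ε; ⁻¹-involutive; ⁻¹-injective; ⁻¹-anti-homo-∙; inverseʳ-unique)
  module +-Solver = Algebra.Solver.CommutativeMonoid +-commutativeMonoid
  module *-Solver = Algebra.Solver.CommutativeMonoid *-commutativeMonoid

  1≢0 : 1# ≢ 0#
  1≢0 = FiniteField.0≢1 F ∘ sym

  -- ι extends x ↦ x⁻¹ by ι 0 = 0, which makes it a permutation of the field.
  ι : Carrier → Carrier
  ι x with x ≟ 0#
  ... | yes _  = 0#
  ... | no x≢0 = proj₁ (FiniteField.inv F x x≢0)

  ι-inverseʳ : ∀ {x} → x ≢ 0# → x * ι x ≡ 1#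
  ι-inverseʳ {x} x≢0 with x ≟ 0#
  ... | yes x≡0  = ⊥-elim (x≢0 x≡0)
  ... | no x≢0′ = proj₂ (FiniteField.inv F x x≢0′)

  ι-0 : ι 0# ≡ 0#
  ι-0 with 0# ≟ 0#
  ... | yes _  = refl
  ... | no 0≢0 = ⊥-elim (0≢0 refl)

  ι-cancelˡ : ∀ {a} → a ≢ 0# → ∀ x → ι a * (a * x) ≡ x
  ι-cancelˡ {a} a≢0 x = begin
    ι a * (a * x)   ≡⟨ *-assoc (ι a) a x ⟨
    (ι a * a) * x   ≡⟨ cong (_* x) (trans (*-comm (ι a) a) (ι-inverseʳ a≢0)) ⟩
    1# * x          ≡⟨ *-identityˡ x ⟩
    x               ∎

  ι-cancelʳ : ∀ {a} → a ≢ 0# → ∀ x → a * (ι a * x) ≡ x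
  ι-cancelʳ {a} a≢0 x = begin
    a * (ι a * x)   ≡⟨ *-assoc a (ι a) x ⟨
    (a * ι a) * x   ≡⟨ cong (_* x) (ι-inverseʳ a≢0) ⟩
    1# * x          ≡⟨ *-identityˡ x ⟩
    x               ∎

  *-cancelˡ : ∀ {a x y} → a ≢ 0# → a * x ≡ a * y → x ≡ y
  *-cancelˡ {a} {x} {y} a≢0 ax≡ay =
    trans (sym (ι-cancelˡ a≢0 x)) (trans (cong (ι a *_) ax≡ay) (ι-cancelˡ a≢0 y))

  zero-divisor : ∀ x y → x * y ≡ 0# → x ≡ 0# ⊎ y ≡ 0#
  zero-divisor x y xy≡0 with x ≟ 0#
  ... | yes x≡0 = inj₁ x≡0
  ... | no x≢0  = inj₂ (*-cancelˡ x≢0 (trans xy≡0 (sym (zeroʳ x))))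

  *-≢0 : ∀ {x y} → x ≢ 0# → y ≢ 0# → x * y ≢ 0#
  *-≢0 {x} {y} x≢0 y≢0 xy≡0 = [ x≢0 , y≢0 ]′ (zero-divisor x y xy≡0)

  ι-≢0 : ∀ {x} → x ≢ 0# → ι x ≢ 0#
  ι-≢0 {x} x≢0 ιx≡0 = 1≢0 (trans (sym (ι-inverseʳ x≢0)) (trans (cong (x *_) ιx≡0) (zeroʳ x)))

  ι-involutive : ∀ x → ι (ι x) ≡ x
  ι-involutive x = by-cases (x ≟ 0#)
    where
    by-cases : Dec (x ≡ 0#) → ι (ι x) ≡ x
    by-cases (yes refl) = trans (cong ι ι-0) ι-0
    by-cases (no x≢0)   =
      *-cancelˡ (ι-≢0 x≢0) (trans (ι-inverseʳ (ι-≢0 x≢0)) (sym (trans (*-comm (ι x) x) (ι-inverseʳ x≢0))))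

  neg-≢0 : ∀ {x} → x ≢ 0# → - x ≢ 0#
  neg-≢0 x≢0 -x≡0 = x≢0 (⁻¹-injective (trans -x≡0 (sym ε⁻¹≈ε)))

  neg-*-neg : ∀ x → (- x) * (- x) ≡ x * x
  neg-*-neg x = begin
    (- x) * (- x)    ≡⟨ -‿distribˡ-* x (- x) ⟨
    - (x * - x)      ≡⟨ cong -_ (-‿distribʳ-* x x) ⟨
    - (- (x * x))    ≡⟨ ⁻¹-involutive (x * x) ⟩
    x * x            ∎

  square-* : ∀ u t → (u * t) * (u * t) ≡ (u * u) * (t * t)
  square-* = *-Solver.solve 2 (λ u t → (u ⊕ t) ⊕ (u ⊕ t) ⊜ (u ⊕ u) ⊕ (t ⊕ t)) refl
    where open *-Solver using (_⊕_; _⊜_)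

  difference-of-squares : ∀ x s → (x + - s) * (x + s) ≡ x * x + - (s * s)
  difference-of-squares x s = begin
    (x + - s) * (x + s)
      ≡⟨ distribˡ (x + - s) x s ⟩
    (x + - s) * x + (x + - s) * s
      ≡⟨ cong₂ _+_ (distribʳ x x (- s)) (distribʳ s x (- s)) ⟩
    (x * x + - s * x) + (x * s + - s * s)
      ≡⟨ cong₂ (λ u v → (x * x + u) + (x * s + v))
                                                        (trans (sym (-‿distribˡ-* s x)) (cong -_ (*-comm s x)))
                                                        (sym (-‿distribˡ-* s s)) ⟩
    (x * x + - (x * s)) + (x * s + - (s * s))
      ≡⟨ +-Solver.solve 4 (λ a b c d → (a ⊕ b) ⊕ (c ⊕ d) ⊜ (a ⊕ d) ⊕ (c ⊕ b)) refl
                                                        (x * x) (- (x * s)) (x * s) (- (s * s)) ⟩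
    (x * x + - (s * s)) + (x * s + - (x * s))
      ≡⟨ cong (_+_ (x * x + - (s * s))) (-‿inverseʳ (x * s)) ⟩
    (x * x + - (s * s)) + 0#
      ≡⟨ +-identityʳ _ ⟩
    x * x + - (s * s)
      ∎
    where open +-Solver using (_⊕_; _⊜_)

  square-roots : ∀ {x s} → x * x ≡ s * s → x ≡ s ⊎ x ≡ - s
  square-roots {x} {s} x²≡s² with zero-divisor (x + - s) (x + s) x²-s²≡0
    where
    x²-s²≡0 : (x + - s) * (x + s) ≡ 0#
    x²-s²≡0 = trans (difference-of-squares x s) (trans (cong (_+ - (s * s)) x²≡s²) (-‿inverseʳ (s * s)))
  ... | inj₁ x-s≡0 = inj₁ (trans (inverseʳ-unique (- s) x (trans (+-comm (- s) x) x-s≡0)) (⁻¹-involutive s))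
  ... | inj₂ x+s≡0 = inj₂ (inverseʳ-unique s x (trans (+-comm s x) x+s≡0))

  -- x ⊖ a is x - a, written so that the group ring product of AddGroup⊕ unfolds to it.
  _⊖_ : Carrier → Carrier → Carrier
  x ⊖ a = - (- x + a)

  ⊖-as-+ : ∀ x a → x ⊖ a ≡ x + - a
  ⊖-as-+ x a = begin
    - (- x + a)       ≡⟨ ⁻¹-anti-homo-∙ (- x) a ⟩
    - a + - (- x)     ≡⟨ cong (_+_ (- a)) (⁻¹-involutive x) ⟩
    - a + x           ≡⟨ +-comm (- a) x ⟩
    x + - a           ∎

  ⊖-identityʳ : ∀ x → x ⊖ 0# ≡ x
  ⊖-identityʳ x = trans (⊖-as-+ x 0#) (trans (cong (_+_ x) ε⁻¹≈ε) (+-identityʳ x))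

  0⊖ : ∀ a → 0# ⊖ a ≡ - a
  0⊖ a = trans (⊖-as-+ 0# a) (+-identityˡ (- a))

  ⊖≡0 : ∀ {x a} → x ⊖ a ≡ 0# → x ≡ a
  ⊖≡0 {x} {a} e = trans (inverseʳ-unique (- a) x (trans (+-comm (- a) x) (trans (sym (⊖-as-+ x a)) e)))
                        (⁻¹-involutive a)

  ⊖-self : ∀ a → a ⊖ a ≡ 0#
  ⊖-self a = trans (⊖-as-+ a a) (-‿inverseʳ a)

  ⊖-⊖ : ∀ x a → x ⊖ (x ⊖ a) ≡ a
  ⊖-⊖ x a = begin
    - (- x + (x ⊖ a))          ≡⟨ cong (λ y → - (- x + y)) (⊖-as-+ x a) ⟩
    - (- x + (x + - a))        ≡⟨ cong -_ (+-assoc (- x) x (- a)) ⟨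
    - ((- x + x) + - a)        ≡⟨ cong (λ y → - (y + - a)) (-‿inverseˡ x) ⟩
    - (0# + - a)               ≡⟨ cong -_ (+-identityˡ (- a)) ⟩
    - (- a)                    ≡⟨ ⁻¹-involutive a ⟩
    a                          ∎

  *-distribˡ-⊖ : ∀ a y → a * (y ⊖ 1#) ≡ (a * y) ⊖ a
  *-distribˡ-⊖ a y = begin
    a * (y ⊖ 1#)          ≡⟨ cong (a *_) (⊖-as-+ y 1#) ⟩
    a * (y + - 1#)        ≡⟨ distribˡ a y (- 1#) ⟩
    a * y + a * - 1#      ≡⟨ cong (_+_ (a * y)) (trans (sym (-‿distribʳ-* a 1#)) (cong -_ (*-identityʳ a))) ⟩
    a * y + - a           ≡⟨ ⊖-as-+ (a * y) a ⟨
    (a * y) ⊖ a           ∎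

  Σ-⊖ : ∀ a (f : Carrier → ℤ) → Σ (λ x → f (x ⊖ a)) ≡ Σ f
  Σ-⊖ a = Σ-bijection (mk↔ₛ′ (_⊖ a) (_+ a) ⊖-+ +-⊖)
    where
    ⊖-+ : ∀ y → (y + a) ⊖ a ≡ y
    ⊖-+ y = trans (⊖-as-+ (y + a) a)
                  (trans (+-assoc y a (- a)) (trans (cong (_+_ y) (-‿inverseʳ a)) (+-identityʳ y)))
    +-⊖ : ∀ x → (x ⊖ a) + a ≡ x
    +-⊖ x = trans (cong (_+ a) (⊖-as-+ x a))
                  (trans (+-assoc x (- a) a) (trans (cong (_+_ x) (-‿inverseˡ a)) (+-identityʳ x)))

  Σ-⊖ˡ : ∀ x (f : Carrier → ℤ) → Σ (λ a → f (x ⊖ a)) ≡ Σ f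
  Σ-⊖ˡ x = Σ-bijection (mk↔ₛ′ (x ⊖_) (x ⊖_) (⊖-⊖ x) (⊖-⊖ x))

  Σ-scale : ∀ {a} → a ≢ 0# → ∀ (f : Carrier → ℤ) → Σ (λ x → f (a * x)) ≡ Σ f
  Σ-scale a≢0 = Σ-bijection (mk↔ₛ′ (_ *_) (ι _ *_) (ι-cancelʳ a≢0) (ι-cancelˡ a≢0))

  δ : Carrier → ℤ
  δ x = ⟦ x ≟ 0# ⟧

  δ-0 : δ 0# ≡ 1ℤ
  δ-0 = ⟦⟧-yes refl (0# ≟ 0#)

  δ-≢0 : ∀ {x} → x ≢ 0# → δ x ≡ 0ℤ
  δ-≢0 {x} x≢0 = ⟦⟧-no x≢0 (x ≟ 0#)

  δ-⊖ : ∀ x a → δ (x ⊖ a) ≡ ⟦ x ≟ a ⟧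
  δ-⊖ x a = ⟦⟧-cong ⊖≡0 (λ { refl → ⊖-self x }) ((x ⊖ a) ≟ 0#) (x ≟ a)

  Σ-δ : Σ δ ≡ 1ℤ
  Σ-δ = Σ-indicator 0# (_≟ 0#)

  data χ-View (x : Carrier) (c : ℤ) : Set where
    zero      : x ≡ 0# → c ≡ 0ℤ → χ-View x c
    square    : x ≢ 0# → IsSquare x → c ≡ 1ℤ → χ-View x c
    nonsquare : x ≢ 0# → ¬ IsSquare x → c ≡ -1ℤ → χ-View x c

  χ-view : ∀ x → χ-View x (χ x)
  χ-view x with x ≟ 0#
  ... | yes x≡0 = zero x≡0 refl
  ... | no x≢0 with isSquare? x
  ...   | yes x□ = square x≢0 x□ refl
  ...   | no ¬x□ = nonsquare x≢0 ¬x□ refl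

  χ-0 : χ 0# ≡ 0ℤ
  χ-0 with χ-view 0#
  ... | zero _ χ0≡0        = χ0≡0
  ... | square 0≢0 _ _     = ⊥-elim (0≢0 refl)
  ... | nonsquare 0≢0 _ _  = ⊥-elim (0≢0 refl)

  χ-square : ∀ {x} → x ≢ 0# → IsSquare x → χ x ≡ 1ℤ
  χ-square {x} x≢0 x□ with χ-view x
  ... | zero x≡0 _         = ⊥-elim (x≢0 x≡0)
  ... | square _ _ χx≡1    = χx≡1
  ... | nonsquare _ ¬x□ _  = ⊥-elim (¬x□ x□)

  χ-nonsquare : ∀ {x} → x ≢ 0# → ¬ IsSquare x → χ x ≡ -1ℤ
  χ-nonsquare {x} x≢0 ¬x□ with χ-view x
  ... | zero x≡0 _          = ⊥-elim (x≢0 x≡0)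
  ... | square _ x□ _       = ⊥-elim (¬x□ x□)
  ... | nonsquare _ _ χx≡-1 = χx≡-1

  χ-1 : χ 1# ≡ 1ℤ
  χ-1 = χ-square 1≢0 (1# , *-identityˡ 1#)

  χ-unit : ∀ {x} → x ≢ 0# → χ x ≡ 1ℤ ⊎ χ x ≡ -1ℤ
  χ-unit {x} x≢0 with χ-view x
  ... | zero x≡0 _          = ⊥-elim (x≢0 x≡0)
  ... | square _ _ χx≡1     = inj₁ χx≡1
  ... | nonsquare _ _ χx≡-1 = inj₂ χx≡-1

  χ≤1 : ∀ x → χ x ℤ.≤ 1ℤ
  χ≤1 x with χ-view x
  ... | zero _ χx≡0         = subst (ℤ._≤ 1ℤ) (sym χx≡0) (ℤ.+≤+ ℕ.z≤n)
  ... | square _ _ χx≡1     = subst (ℤ._≤ 1ℤ) (sym χx≡1) ℤP.≤-refl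
  ... | nonsquare _ _ χx≡-1 = subst (ℤ._≤ 1ℤ) (sym χx≡-1) ℤ.-≤+

  χ-*-self : ∀ x → χ x *ℤ χ x ≡ 1ℤ -ℤ δ x
  χ-*-self x with χ-view x
  ... | zero refl χx≡0        = trans (cong (λ c → c *ℤ c) χx≡0) (cong (1ℤ -ℤ_) (sym δ-0))
  ... | square x≢0 _ χx≡1     = trans (cong (λ c → c *ℤ c) χx≡1) (cong (1ℤ -ℤ_) (sym (δ-≢0 x≢0)))
  ... | nonsquare x≢0 _ χx≡-1 = trans (cong (λ c → c *ℤ c) χx≡-1) (cong (1ℤ -ℤ_) (sym (δ-≢0 x≢0)))

  δ-neg : ∀ a → δ (- a) ≡ δ a
  δ-neg a = ⟦⟧-cong (λ -a≡0 → trans (sym (⁻¹-involutive a)) (trans (cong -_ -a≡0) ε⁻¹≈ε))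
                    (λ a≡0 → trans (cong -_ a≡0) ε⁻¹≈ε) ((- a) ≟ 0#) (a ≟ 0#)

  corr : (Carrier → ℤ) → (Carrier → ℤ) → Carrier → ℤ
  corr f g a = Σ (λ x → f x *ℤ g (x ⊖ a))

  corr-linearˡ : ∀ (f g h : Carrier → ℤ) c a →
                 corr (λ x → f x -ℤ c *ℤ g x) h a ≡ corr f h a -ℤ c *ℤ corr g h a
  corr-linearˡ f g h c a = begin
    Σ (λ x → (f x -ℤ c *ℤ g x) *ℤ h (x ⊖ a))
      ≡⟨ Σ-cong (λ x → expand c (f x) (g x) (h (x ⊖ a))) ⟩
    Σ (λ x → f x *ℤ h (x ⊖ a) -ℤ c *ℤ (g x *ℤ h (x ⊖ a)))
      ≡⟨ Σ-sub (λ x → f x *ℤ h (x ⊖ a)) (λ x → c *ℤ (g x *ℤ h (x ⊖ a))) ⟩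
    corr f h a -ℤ Σ (λ x → c *ℤ (g x *ℤ h (x ⊖ a)))
      ≡⟨ cong (corr f h a -ℤ_) (Σ-*ˡ c (λ x → g x *ℤ h (x ⊖ a))) ⟩
    corr f h a -ℤ c *ℤ corr g h a
      ∎
    where
    expand : ∀ c u v w → (u -ℤ c *ℤ v) *ℤ w ≡ u *ℤ w -ℤ c *ℤ (v *ℤ w)
    expand = solve-∀

  corr-linearʳ : ∀ (f g h : Carrier → ℤ) c a →
                 corr f (λ y → g y -ℤ c *ℤ h y) a ≡ corr f g a -ℤ c *ℤ corr f h a
  corr-linearʳ f g h c a = begin
    Σ (λ x → f x *ℤ (g (x ⊖ a) -ℤ c *ℤ h (x ⊖ a)))
      ≡⟨ Σ-cong (λ x → expand c (f x) (g (x ⊖ a)) (h (x ⊖ a))) ⟩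
    Σ (λ x → f x *ℤ g (x ⊖ a) -ℤ c *ℤ (f x *ℤ h (x ⊖ a)))
      ≡⟨ Σ-sub (λ x → f x *ℤ g (x ⊖ a)) (λ x → c *ℤ (f x *ℤ h (x ⊖ a))) ⟩
    corr f g a -ℤ Σ (λ x → c *ℤ (f x *ℤ h (x ⊖ a)))
      ≡⟨ cong (corr f g a -ℤ_) (Σ-*ˡ c (λ x → f x *ℤ h (x ⊖ a))) ⟩
    corr f g a -ℤ c *ℤ corr f h a
      ∎
    where
    expand : ∀ c u v w → u *ℤ (v -ℤ c *ℤ w) ≡ u *ℤ v -ℤ c *ℤ (u *ℤ w)
    expand = solve-∀

  corr-11 : ∀ a → corr (λ _ → 1ℤ) (λ _ → 1ℤ) a ≡ + q
  corr-11 a = Σ-1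

  corr-1δ : ∀ a → corr (λ _ → 1ℤ) δ a ≡ 1ℤ
  corr-1δ a = trans (Σ-cong (λ x → ℤP.*-identityˡ (δ (x ⊖ a)))) (trans (Σ-⊖ a δ) Σ-δ)

  corr-δ1 : ∀ a → corr δ (λ _ → 1ℤ) a ≡ 1ℤ
  corr-δ1 a = trans (Σ-cong (λ x → ℤP.*-identityʳ (δ x))) Σ-δ

  corr-δ : ∀ f a → corr δ f a ≡ f (- a)
  corr-δ f a = begin
    Σ (λ x → δ x *ℤ f (x ⊖ a))   ≡⟨ Σ-cong (λ x → ℤP.*-comm (δ x) (f (x ⊖ a))) ⟩
    Σ (λ x → f (x ⊖ a) *ℤ δ x)   ≡⟨ Σ-select (λ x → f (x ⊖ a)) 0# (_≟ 0#) ⟩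
    f (0# ⊖ a)                   ≡⟨ cong f (0⊖ a) ⟩
    f (- a)                      ∎

  corr-δδ : ∀ a → corr δ δ a ≡ δ a
  corr-δδ a = trans (corr-δ δ a) (δ-neg a)

  corr-χδ : ∀ a → corr χ δ a ≡ χ a
  corr-χδ a = trans (Σ-cong (λ x → cong (χ x *ℤ_) (δ-⊖ x a))) (Σ-select χ a (_≟ a))

module QuadraticCharacter {q h : ℕ} (F : FiniteField q) (q≡1+2h : q ≡ suc (h ℕ.+ h)) where

  open import Data.Integer using () renaming (_+_ to _+ℤ_; _*_ to _*ℤ_; _-_ to _-ℤ_)
  open import Algebra.Bundles using (CommutativeRing)
  open ≡-Reasoning

  open FiniteFieldProperties F public
  open CommutativeRing ring using
    ( +-assoc; +-identityʳ; -‿inverseʳ; *-comm; *-identityˡ; distribʳ; zeroˡ; zeroʳ; +-group )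
  open import Algebra.Properties.Group +-group using (⁻¹-involutive; identityʳ-unique)
  open import Algebra.Properties.Ring (CommutativeRing.ring ring) using (-1*x≈-x)

  odd-order : Odd (+ q)
  odd-order = + h , (begin
    + q                  ≡⟨ cong +_ q≡1+2h ⟩
    + suc (h ℕ.+ h)      ≡⟨ ℤP.pos-+ 1 (h ℕ.+ h) ⟩
    1ℤ +ℤ + (h ℕ.+ h)    ≡⟨ cong (1ℤ +ℤ_) (ℤP.pos-+ h h) ⟩
    1ℤ +ℤ (+ h +ℤ + h)   ∎)

  h≢0 : h ≢ 0
  h≢0 refl = FiniteField.0≢1 F (index-injective (all-equal q≡1+2h (index 0#) (index 1#)))
    where
    all-equal : ∀ {n} → n ≡ 1 → (i j : Fin n) → i ≡ j
    all-equal refl zero zero = refl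

  -- If 1 + 1 = 0 then x ↦ x + 1 is a fixed-point-free involution, so q would be even.
  1+1≢0 : 1# + 1# ≢ 0#
  1+1≢0 2≡0 = even⇒¬odd (k , q≡k+k) odd-order
    where
    σσ : ∀ x → (x + 1#) + 1# ≡ x
    σσ x = trans (+-assoc x 1# 1#) (trans (cong (_+_ x) 2≡0) (+-identityʳ x))
    no-fixed-point : ∀ x → ⟦ (x + 1#) ≟ x ⟧ *ℤ 1ℤ ≡ 0ℤ
    no-fixed-point x = trans (ℤP.*-identityʳ _) (⟦⟧-no (1≢0 ∘ identityʳ-unique x 1#) ((x + 1#) ≟ x))
    pairing = Σ-involution (_+ 1#) σσ (λ x → (x + 1#) ≟ x) (λ _ → 1ℤ) (λ _ → refl)
    k = proj₁ pairing
    q≡k+k : + q ≡ k +ℤ k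
    q≡k+k = begin
      + q                                                  ≡⟨ Σ-1 ⟨
      Σ (λ _ → 1ℤ)                                         ≡⟨ proj₂ pairing ⟩
      Σ (λ x → ⟦ (x + 1#) ≟ x ⟧ *ℤ 1ℤ) +ℤ (k +ℤ k)         ≡⟨ cong (_+ℤ (k +ℤ k)) (trans (Σ-cong no-fixed-point) Σ-0) ⟩
      0ℤ +ℤ (k +ℤ k)                                       ≡⟨ ℤP.+-identityˡ (k +ℤ k) ⟩
      k +ℤ k                                               ∎

  x≡-x⇒x≡0 : ∀ {x} → x ≡ - x → x ≡ 0#
  x≡-x⇒x≡0 {x} x≡-x = [ ⊥-elim ∘ 1+1≢0 , (λ x≡0 → x≡0) ]′ (zero-divisor (1# + 1#) x 2x≡0)
    where
    2x≡0 : (1# + 1#) * x ≡ 0#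
    2x≡0 = begin
      (1# + 1#) * x     ≡⟨ distribʳ x 1# 1# ⟩
      1# * x + 1# * x   ≡⟨ cong₂ _+_ (*-identityˡ x) (*-identityˡ x) ⟩
      x + x             ≡⟨ cong (_+_ x) x≡-x ⟩
      x + - x           ≡⟨ -‿inverseʳ x ⟩
      0#                ∎

  nonzero-square-roots : ∀ y → Σ (λ x → (1ℤ -ℤ δ x) *ℤ ⟦ y ≟ (x * x) ⟧) ≡ 1ℤ +ℤ χ y -ℤ δ y
  nonzero-square-roots y with χ-view y
  ... | zero refl χy≡0 = begin
    Σ (λ x → (1ℤ -ℤ δ x) *ℤ ⟦ 0# ≟ (x * x) ⟧)   ≡⟨ Σ-cong no-root ⟩
    Σ (λ _ → 0ℤ)                              ≡⟨ Σ-0 ⟩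
    0ℤ                                        ≡⟨ cong₂ (λ c d → 1ℤ +ℤ c -ℤ d) χy≡0 δ-0 ⟨
    1ℤ +ℤ χ 0# -ℤ δ 0#                        ∎
    where
    no-root : ∀ x → (1ℤ -ℤ δ x) *ℤ ⟦ 0# ≟ (x * x) ⟧ ≡ 0ℤ
    no-root x with x ≟ 0#
    ... | yes _  = refl
    ... | no x≢0 = cong (1ℤ *ℤ_) (⟦⟧-no (*-≢0 x≢0 x≢0 ∘ sym) (0# ≟ (x * x)))
  ... | nonsquare y≢0 ¬y□ χy≡-1 = begin
    Σ (λ x → (1ℤ -ℤ δ x) *ℤ ⟦ y ≟ (x * x) ⟧)    ≡⟨ Σ-cong no-root ⟩
    Σ (λ _ → 0ℤ)                              ≡⟨ Σ-0 ⟩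
    0ℤ                                        ≡⟨ cong₂ (λ c d → 1ℤ +ℤ c -ℤ d) χy≡-1 (δ-≢0 y≢0) ⟨
    1ℤ +ℤ χ y -ℤ δ y                          ∎
    where
    no-root : ∀ x → (1ℤ -ℤ δ x) *ℤ ⟦ y ≟ (x * x) ⟧ ≡ 0ℤ
    no-root x = trans (cong ((1ℤ -ℤ δ x) *ℤ_) (⟦⟧-no (λ y≡x² → ¬y□ (x , sym y≡x²)) (y ≟ (x * x))))
                      (ℤP.*-zeroʳ (1ℤ -ℤ δ x))
  ... | square y≢0 (s , s²≡y) χy≡1 = begin
    Σ (λ x → (1ℤ -ℤ δ x) *ℤ ⟦ y ≟ (x * x) ⟧)        ≡⟨ Σ-cong two-roots ⟩
    Σ (λ x → ⟦ x ≟ s ⟧ +ℤ ⟦ x ≟ (- s) ⟧)            ≡⟨ Σ-+ (λ x → ⟦ x ≟ s ⟧) (λ x → ⟦ x ≟ (- s) ⟧) ⟩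
    Σ (λ x → ⟦ x ≟ s ⟧) +ℤ Σ (λ x → ⟦ x ≟ (- s) ⟧)  ≡⟨ cong₂ _+ℤ_ (Σ-indicator s (_≟ s)) (Σ-indicator (- s) (_≟ (- s))) ⟩
    1ℤ +ℤ 1ℤ                                        ≡⟨ cong₂ (λ c d → 1ℤ +ℤ c -ℤ d) χy≡1 (δ-≢0 y≢0) ⟨
    1ℤ +ℤ χ y -ℤ δ y                                ∎
    where
    s≢0 : s ≢ 0#
    s≢0 s≡0 = y≢0 (trans (sym s²≡y) (trans (cong (λ t → t * t) s≡0) (zeroˡ 0#)))
    root : ∀ {x} → x ≢ 0# → x * x ≡ y → (1ℤ -ℤ δ x) *ℤ ⟦ y ≟ (x * x) ⟧ ≡ 1ℤ
    root {x} x≢0 x²≡y = cong₂ _*ℤ_ (cong (1ℤ -ℤ_) (δ-≢0 x≢0)) (⟦⟧-yes (sym x²≡y) (y ≟ (x * x)))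
    two-roots : ∀ x → (1ℤ -ℤ δ x) *ℤ ⟦ y ≟ (x * x) ⟧ ≡ ⟦ x ≟ s ⟧ +ℤ ⟦ x ≟ (- s) ⟧
    two-roots x with x ≟ s | x ≟ (- s)
    ... | yes refl | yes x≡-x = ⊥-elim (s≢0 (x≡-x⇒x≡0 x≡-x))
    ... | yes refl | no _     = root s≢0 s²≡y
    ... | no _     | yes refl = root (neg-≢0 s≢0) (trans (neg-*-neg s) s²≡y)
    ... | no x≢s   | no x≢-s  = trans (cong ((1ℤ -ℤ δ x) *ℤ_) (⟦⟧-no not-root (y ≟ (x * x)))) (ℤP.*-zeroʳ (1ℤ -ℤ δ x))
      where
      not-root : y ≢ x * x
      not-root y≡x² = [ x≢s , x≢-s ]′ (square-roots (trans (sym y≡x²) (sym s²≡y)))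

  -- Counting the pairs (x, y) with x ≠ 0 and y = x² by columns and by rows.
  Σχ≡0 : Σ χ ≡ 0ℤ
  Σχ≡0 = begin
    Σ χ                                                      ≡⟨ rearrange (Σ (λ _ → 1ℤ)) (Σ χ) (Σ δ) ⟩
    (Σ (λ _ → 1ℤ) +ℤ Σ χ -ℤ Σ δ) -ℤ (Σ (λ _ → 1ℤ) -ℤ Σ δ)    ≡⟨ cong₂ _-ℤ_ Σ-1+χ-δ (Σ-sub (λ _ → 1ℤ) δ) ⟨
    Σ (λ y → 1ℤ +ℤ χ y -ℤ δ y) -ℤ Σ (λ x → 1ℤ -ℤ δ x)        ≡⟨ cong (_-ℤ Σ (λ x → 1ℤ -ℤ δ x)) double-count ⟩
    Σ (λ x → 1ℤ -ℤ δ x) -ℤ Σ (λ x → 1ℤ -ℤ δ x)              ≡⟨ ℤP.+-inverseʳ (Σ (λ x → 1ℤ -ℤ δ x)) ⟩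
    0ℤ                                                       ∎
    where
    rearrange : ∀ a b c → b ≡ (a +ℤ b -ℤ c) -ℤ (a -ℤ c)
    rearrange = solve-∀
    Σ-1+χ-δ : Σ (λ y → 1ℤ +ℤ χ y -ℤ δ y) ≡ Σ (λ _ → 1ℤ) +ℤ Σ χ -ℤ Σ δ
    Σ-1+χ-δ = trans (Σ-sub (λ y → 1ℤ +ℤ χ y) δ) (cong (_-ℤ Σ δ) (Σ-+ (λ _ → 1ℤ) χ))
    root-pair : Carrier → Carrier → ℤ
    root-pair x y = (1ℤ -ℤ δ x) *ℤ ⟦ y ≟ (x * x) ⟧
    double-count : Σ (λ y → 1ℤ +ℤ χ y -ℤ δ y) ≡ Σ (λ x → 1ℤ -ℤ δ x)
    double-count = begin
      Σ (λ y → 1ℤ +ℤ χ y -ℤ δ y)           ≡⟨ Σ-cong nonzero-square-roots ⟨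
      Σ (λ y → Σ (λ x → root-pair x y))    ≡⟨ Σ-comm (λ y x → root-pair x y) ⟩
      Σ (λ x → Σ (λ y → root-pair x y))    ≡⟨ Σ-cong row ⟩
      Σ (λ x → 1ℤ -ℤ δ x)                  ∎
      where
      row : ∀ x → Σ (λ y → root-pair x y) ≡ 1ℤ -ℤ δ x
      row x = begin
        Σ (λ y → root-pair x y)                    ≡⟨ Σ-*ˡ (1ℤ -ℤ δ x) (λ y → ⟦ y ≟ (x * x) ⟧) ⟩
        (1ℤ -ℤ δ x) *ℤ Σ (λ y → ⟦ y ≟ (x * x) ⟧)     ≡⟨ cong ((1ℤ -ℤ δ x) *ℤ_) (Σ-indicator (x * x) (_≟ (x * x))) ⟩
        (1ℤ -ℤ δ x) *ℤ 1ℤ                          ≡⟨ ℤP.*-identityʳ (1ℤ -ℤ δ x) ⟩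
        1ℤ -ℤ δ x                                  ∎

  χ-*-square : ∀ {s} → s ≢ 0# → IsSquare s → ∀ y → χ (s * y) ≡ χ y
  χ-*-square {s} s≢0 (u , u²≡s) y with χ-view y
  ... | zero refl _ = cong χ (zeroʳ s)
  ... | square y≢0 (t , t²≡y) χy≡1 =
    trans (χ-square (*-≢0 s≢0 y≢0) (u * t , trans (square-* u t) (cong₂ _*_ u²≡s t²≡y))) (sym χy≡1)
  ... | nonsquare y≢0 ¬y□ χy≡-1 = trans (χ-nonsquare (*-≢0 s≢0 y≢0) ¬sy□) (sym χy≡-1)
    where
    u≢0 : u ≢ 0#
    u≢0 u≡0 = s≢0 (trans (sym u²≡s) (trans (cong (λ v → v * v) u≡0) (zeroˡ 0#)))
    ¬sy□ : ¬ IsSquare (s * y)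
    ¬sy□ (w , w²≡sy) = ¬y□ (ι u * w , (begin
      (ι u * w) * (ι u * w)
        ≡⟨ square-* (ι u) w ⟩
      (ι u * ι u) * (w * w)
        ≡⟨ cong ((ι u * ι u) *_) (trans w²≡sy (cong (_* y) (sym u²≡s))) ⟩
      (ι u * ι u) * ((u * u) * y)
        ≡⟨ *-Solver.solve 3 (λ a b c → (a ⊕ a) ⊕ ((b ⊕ b) ⊕ c) ⊜ ((b ⊕ a) ⊕ (b ⊕ a)) ⊕ c) refl (ι u) u y ⟩
      ((u * ι u) * (u * ι u)) * y
        ≡⟨ cong (λ v → (v * v) * y) (ι-inverseʳ u≢0) ⟩
      (1# * 1#) * y
        ≡⟨ trans (cong (_* y) (*-identityˡ 1#)) (*-identityˡ y) ⟩
      y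
        ∎))
      where open *-Solver using (_⊕_; _⊜_)

  χ-*-nonsquare : ∀ {a} → a ≢ 0# → ¬ IsSquare a → ∀ y → χ (a * y) ≡ ℤ.- χ y
  χ-*-nonsquare {a} a≢0 ¬a□ y = begin
    χ (a * y)                       ≡⟨ add-sub (χ (a * y)) (χ y) ⟩
    (χ (a * y) +ℤ χ y) -ℤ χ y       ≡⟨ cong (_-ℤ χ y) (Σ-nonpos sum nonpositive Σsum≡0 y) ⟩
    0ℤ -ℤ χ y                       ≡⟨ ℤP.+-identityˡ (ℤ.- χ y) ⟩
    ℤ.- χ y                         ∎
    where
    add-sub : ∀ c d → c ≡ (c +ℤ d) -ℤ d
    add-sub = solve-∀
    sum : Carrier → ℤ
    sum y = χ (a * y) +ℤ χ y
    Σsum≡0 : Σ sum ≡ 0ℤ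
    Σsum≡0 = trans (Σ-+ (λ y → χ (a * y)) χ) (cong₂ _+ℤ_ (trans (Σ-scale a≢0 χ) Σχ≡0) Σχ≡0)
    nonpositive : ∀ y → sum y ℤ.≤ 0ℤ
    nonpositive y with χ-view y
    ... | zero refl χ0≡0 = ℤP.≤-reflexive (cong₂ _+ℤ_ (trans (cong χ (zeroʳ a)) χ0≡0) χ0≡0)
    ... | square y≢0 y□ χy≡1 = ℤP.≤-reflexive (cong₂ _+ℤ_ χay≡-1 χy≡1)
      where
      χay≡-1 : χ (a * y) ≡ -1ℤ
      χay≡-1 = trans (cong χ (*-comm a y)) (trans (χ-*-square y≢0 y□ a) (χ-nonsquare a≢0 ¬a□))
    ... | nonsquare _ _ χy≡-1 = subst (λ c → χ (a * y) +ℤ c ℤ.≤ 0ℤ) (sym χy≡-1) (ℤP.+-monoˡ-≤ -1ℤ (χ≤1 (a * y)))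

  χ-* : ∀ x y → χ (x * y) ≡ χ x *ℤ χ y
  χ-* x y with χ-view x
  ... | zero refl χ0≡0 = trans (cong χ (zeroˡ y)) (trans χ0≡0 (cong (_*ℤ χ y) (sym χ0≡0)))
  ... | square x≢0 x□ χx≡1 =
    trans (χ-*-square x≢0 x□ y) (trans (sym (ℤP.*-identityˡ (χ y))) (cong (_*ℤ χ y) (sym χx≡1)))
  ... | nonsquare x≢0 ¬x□ χx≡-1 =
    trans (χ-*-nonsquare x≢0 ¬x□ y) (trans (sym (ℤP.-1*i≡-i (χ y))) (cong (_*ℤ χ y) (sym χx≡-1)))

  ε : ℤ
  ε = χ (- 1#)

  χ-neg : ∀ x → χ (- x) ≡ ε *ℤ χ x
  χ-neg x = trans (cong χ (sym (-1*x≈-x x))) (χ-* (- 1#) x)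

  corr-χ1 : ∀ a → corr χ (λ _ → 1ℤ) a ≡ 0ℤ
  corr-χ1 a = trans (Σ-cong (λ x → ℤP.*-identityʳ (χ x))) Σχ≡0

  corr-1χ : ∀ a → corr (λ _ → 1ℤ) χ a ≡ 0ℤ
  corr-1χ a = trans (Σ-cong (λ x → ℤP.*-identityˡ (χ (x ⊖ a)))) (trans (Σ-⊖ a χ) Σχ≡0)

  corr-δχ : ∀ a → corr δ χ a ≡ ε *ℤ χ a
  corr-δχ a = trans (corr-δ χ a) (χ-neg a)

  corr-χχ-0 : corr χ χ 0# ≡ + q -ℤ 1ℤ
  corr-χχ-0 = begin
    Σ (λ x → χ x *ℤ χ (x ⊖ 0#))   ≡⟨ Σ-cong (λ x → trans (cong (λ y → χ x *ℤ χ y) (⊖-identityʳ x)) (χ-*-self x)) ⟩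
    Σ (λ x → 1ℤ -ℤ δ x)           ≡⟨ Σ-sub (λ _ → 1ℤ) δ ⟩
    Σ (λ _ → 1ℤ) -ℤ Σ δ           ≡⟨ cong₂ _-ℤ_ Σ-1 Σ-δ ⟩
    + q -ℤ 1ℤ                     ∎

  -- Substituting x = a y shows that the autocorrelation of χ is constant off 0.
  corr-χχ-scale : ∀ {a} → a ≢ 0# → corr χ χ a ≡ corr χ χ 1#
  corr-χχ-scale {a} a≢0 = begin
    Σ (λ x → χ x *ℤ χ (x ⊖ a))
      ≡⟨ Σ-scale a≢0 (λ x → χ x *ℤ χ (x ⊖ a)) ⟨
    Σ (λ y → χ (a * y) *ℤ χ ((a * y) ⊖ a))
      ≡⟨ Σ-cong (λ y → cong (λ z → χ (a * y) *ℤ χ z) (sym (*-distribˡ-⊖ a y))) ⟩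
    Σ (λ y → χ (a * y) *ℤ χ (a * (y ⊖ 1#)))
      ≡⟨ Σ-cong (λ y → cong₂ _*ℤ_ (χ-* a y) (χ-* a (y ⊖ 1#))) ⟩
    Σ (λ y → (χ a *ℤ χ y) *ℤ (χ a *ℤ χ (y ⊖ 1#)))
      ≡⟨ Σ-cong (λ y → regroup (χ a) (χ y) (χ (y ⊖ 1#))) ⟩
    Σ (λ y → (χ a *ℤ χ a) *ℤ (χ y *ℤ χ (y ⊖ 1#)))
      ≡⟨ Σ-*ˡ (χ a *ℤ χ a) (λ y → χ y *ℤ χ (y ⊖ 1#)) ⟩
    (χ a *ℤ χ a) *ℤ corr χ χ 1#
      ≡⟨ cong (_*ℤ corr χ χ 1#) (trans (χ-*-self a) (cong (1ℤ -ℤ_) (δ-≢0 a≢0))) ⟩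
    1ℤ *ℤ corr χ χ 1#
      ≡⟨ ℤP.*-identityˡ (corr χ χ 1#) ⟩
    corr χ χ 1#
      ∎
    where
    regroup : ∀ c u v → (c *ℤ u) *ℤ (c *ℤ v) ≡ (c *ℤ c) *ℤ (u *ℤ v)
    regroup = solve-∀

  Σ-corr-χχ : Σ (corr χ χ) ≡ 0ℤ
  Σ-corr-χχ = begin
    Σ (λ a → Σ (λ x → χ x *ℤ χ (x ⊖ a)))      ≡⟨ Σ-comm (λ a x → χ x *ℤ χ (x ⊖ a)) ⟩
    Σ (λ x → Σ (λ a → χ x *ℤ χ (x ⊖ a)))      ≡⟨ Σ-cong (λ x → Σ-*ˡ (χ x) (λ a → χ (x ⊖ a))) ⟩
    Σ (λ x → χ x *ℤ Σ (λ a → χ (x ⊖ a)))      ≡⟨ Σ-cong (λ x → cong (χ x *ℤ_) (trans (Σ-⊖ˡ x χ) Σχ≡0)) ⟩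
    Σ (λ x → χ x *ℤ 0ℤ)                       ≡⟨ Σ-cong (λ x → ℤP.*-zeroʳ (χ x)) ⟩
    Σ (λ _ → 0ℤ)                              ≡⟨ Σ-0 ⟩
    0ℤ                                        ∎

  -- The autocorrelation at a ≠ 0 is a Jacobi sum; its value follows from Σ (corr χ χ) = 0.
  corr-χχ-≢0 : ∀ {a} → a ≢ 0# → corr χ χ a ≡ -1ℤ
  corr-χχ-≢0 {a} a≢0 = trans (corr-χχ-scale a≢0) (begin
    J₁                       ≡⟨ add-sub J₁ ⟩
    (1ℤ +ℤ J₁) -ℤ 1ℤ         ≡⟨ cong (_-ℤ 1ℤ) 1+J₁≡0 ⟩
    -1ℤ                      ∎)
    where
    J₁ = corr χ χ 1#
    C₀ = corr χ χ 0#
    add-sub : ∀ j → j ≡ (1ℤ +ℤ j) -ℤ 1ℤ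
    add-sub = solve-∀
    at-0 : ∀ c j → c ≡ c *ℤ 1ℤ +ℤ j *ℤ (1ℤ -ℤ 1ℤ)
    at-0 = solve-∀
    off-0 : ∀ c j → j ≡ c *ℤ 0ℤ +ℤ j *ℤ (1ℤ -ℤ 0ℤ)
    off-0 = solve-∀
    factor : ∀ c j → c *ℤ 1ℤ +ℤ j *ℤ c ≡ c *ℤ (1ℤ +ℤ j)
    factor = solve-∀
    split : ∀ b → corr χ χ b ≡ C₀ *ℤ δ b +ℤ J₁ *ℤ (1ℤ -ℤ δ b)
    split b with b ≟ 0#
    ... | yes refl = at-0 C₀ J₁
    ... | no b≢0   = trans (corr-χχ-scale b≢0) (off-0 C₀ J₁)
    [q-1][1+J₁]≡0 : (+ q -ℤ 1ℤ) *ℤ (1ℤ +ℤ J₁) ≡ 0ℤ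
    [q-1][1+J₁]≡0 = begin
      (+ q -ℤ 1ℤ) *ℤ (1ℤ +ℤ J₁)                          ≡⟨ factor (+ q -ℤ 1ℤ) J₁ ⟨
      (+ q -ℤ 1ℤ) *ℤ 1ℤ +ℤ J₁ *ℤ (+ q -ℤ 1ℤ)             ≡⟨ cong (λ d → (+ q -ℤ 1ℤ) *ℤ d +ℤ J₁ *ℤ (+ q -ℤ d)) Σ-δ ⟨
      (+ q -ℤ 1ℤ) *ℤ Σ δ +ℤ J₁ *ℤ (+ q -ℤ Σ δ)           ≡⟨ cong₂ (λ c d → c *ℤ Σ δ +ℤ J₁ *ℤ (d -ℤ Σ δ)) corr-χχ-0 Σ-1 ⟨
      C₀ *ℤ Σ δ +ℤ J₁ *ℤ (Σ (λ _ → 1ℤ) -ℤ Σ δ)           ≡⟨ cong₂ (λ c d → c +ℤ J₁ *ℤ d) (Σ-*ˡ C₀ δ) (Σ-sub (λ _ → 1ℤ) δ) ⟨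
      Σ (λ b → C₀ *ℤ δ b) +ℤ J₁ *ℤ Σ (λ b → 1ℤ -ℤ δ b)   ≡⟨ cong (Σ (λ b → C₀ *ℤ δ b) +ℤ_) (Σ-*ˡ J₁ (λ b → 1ℤ -ℤ δ b)) ⟨
      Σ (λ b → C₀ *ℤ δ b) +ℤ Σ (λ b → J₁ *ℤ (1ℤ -ℤ δ b)) ≡⟨ Σ-+ (λ b → C₀ *ℤ δ b) (λ b → J₁ *ℤ (1ℤ -ℤ δ b)) ⟨
      Σ (λ b → C₀ *ℤ δ b +ℤ J₁ *ℤ (1ℤ -ℤ δ b))           ≡⟨ Σ-cong split ⟨
      Σ (corr χ χ)                                       ≡⟨ Σ-corr-χχ ⟩
      0ℤ                                                 ∎
    q-1≡2h : + q -ℤ 1ℤ ≡ + (h ℕ.+ h)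
    q-1≡2h = cong (λ n → + n -ℤ 1ℤ) q≡1+2h
    1+J₁≡0 : 1ℤ +ℤ J₁ ≡ 0ℤ
    1+J₁≡0 = ℤP.*-cancelˡ-≡ (+ (h ℕ.+ h)) (1ℤ +ℤ J₁) 0ℤ {{ℕ.≢-nonZero (h≢0 ∘ ℕP.m+n≡0⇒m≡0 h)}}
               (trans (cong (_*ℤ (1ℤ +ℤ J₁)) (sym q-1≡2h)) (trans [q-1][1+J₁]≡0 (sym (ℤP.*-zeroʳ (+ (h ℕ.+ h))))))

  corr-χχ : ∀ a → corr χ χ a ≡ + q *ℤ δ a -ℤ 1ℤ
  corr-χχ a with a ≟ 0#
  ... | yes refl = trans corr-χχ-0 (cong (_-ℤ 1ℤ) (sym (ℤP.*-identityʳ (+ q))))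
  ... | no a≢0   = trans (corr-χχ-≢0 a≢0) (cong (_-ℤ 1ℤ) (sym (ℤP.*-zeroʳ (+ q))))

  nonzero-square : Carrier → ℤ
  nonzero-square x = ⟦ χ x ℤ.≟ 1ℤ ⟧

  Σ-nonzero-square : Σ nonzero-square ≡ + h
  Σ-nonzero-square = ℤP.*-cancelˡ-≡ (+ 2) (Σ nonzero-square) (+ h) (begin
    + 2 *ℤ Σ nonzero-square                          ≡⟨ double (Σ nonzero-square) ⟩
    Σ nonzero-square +ℤ Σ nonzero-square             ≡⟨ Σ-+ nonzero-square nonzero-square ⟨
    Σ (λ x → nonzero-square x +ℤ nonzero-square x)   ≡⟨ Σ-cong twice ⟩
    Σ (λ x → χ x +ℤ (1ℤ -ℤ δ x))                     ≡⟨ Σ-+ χ (λ x → 1ℤ -ℤ δ x) ⟩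
    Σ χ +ℤ Σ (λ x → 1ℤ -ℤ δ x)                       ≡⟨ cong₂ _+ℤ_ Σχ≡0 (Σ-sub (λ _ → 1ℤ) δ) ⟩
    0ℤ +ℤ (Σ (λ _ → 1ℤ) -ℤ Σ δ)                      ≡⟨ cong₂ (λ c d → 0ℤ +ℤ (c -ℤ d)) Σ-1 Σ-δ ⟩
    0ℤ +ℤ (+ q -ℤ 1ℤ)                                ≡⟨ cong (λ n → 0ℤ +ℤ (+ n -ℤ 1ℤ)) q≡1+2h ⟩
    0ℤ +ℤ + (h ℕ.+ h)                                ≡⟨ ℤP.pos-+ h h ⟩
    + h +ℤ + h                                       ≡⟨ double (+ h) ⟨
    + 2 *ℤ + h                                       ∎)
    where
    double : ∀ i → + 2 *ℤ i ≡ i +ℤ i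
    double = solve-∀
    twice : ∀ x → nonzero-square x +ℤ nonzero-square x ≡ χ x +ℤ (1ℤ -ℤ δ x)
    twice x with χ-view x
    ... | zero refl χ0≡0           rewrite χ0≡0 | δ-0 = refl
    ... | square x≢0 _ χx≡1        rewrite χx≡1 | δ-≢0 x≢0 = refl
    ... | nonsquare x≢0 _ χx≡-1    rewrite χx≡-1 | δ-≢0 x≢0 = refl

  ι-1 : ι 1# ≡ 1#
  ι-1 = trans (sym (*-identityˡ (ι 1#))) (ι-inverseʳ 1≢0)

  χ-ι : ∀ x → χ (ι x) ≡ χ x
  χ-ι x = by-cases (x ≟ 0#)
    where
    by-cases : Dec (x ≡ 0#) → χ (ι x) ≡ χ x
    by-cases (yes refl) = cong χ ι-0
    by-cases (no x≢0)   = same-sign (χ-unit x≢0) (χ-unit (ι-≢0 x≢0))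
      where
      product≡1 : χ x *ℤ χ (ι x) ≡ 1ℤ
      product≡1 = trans (sym (χ-* x (ι x))) (trans (cong χ (ι-inverseʳ x≢0)) χ-1)
      same-sign : χ x ≡ 1ℤ ⊎ χ x ≡ -1ℤ → χ (ι x) ≡ 1ℤ ⊎ χ (ι x) ≡ -1ℤ → χ (ι x) ≡ χ x
      same-sign (inj₁ χx≡1)  (inj₁ χιx≡1)  = trans χιx≡1 (sym χx≡1)
      same-sign (inj₂ χx≡-1) (inj₂ χιx≡-1) = trans χιx≡-1 (sym χx≡-1)
      same-sign (inj₁ χx≡1)  (inj₂ χιx≡-1) with trans (sym (cong₂ _*ℤ_ χx≡1 χιx≡-1)) product≡1
      ... | ()
      same-sign (inj₂ χx≡-1) (inj₁ χιx≡1)  with trans (sym (cong₂ _*ℤ_ χx≡-1 χιx≡1)) product≡1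
      ... | ()

  -- x ↦ - x pairs off the nonzero squares.
  ε≡1⇒even : ε ≡ 1ℤ → Even (+ h)
  ε≡1⇒even ε≡1 = k , (begin
    + h                                                       ≡⟨ Σ-nonzero-square ⟨
    Σ nonzero-square                                          ≡⟨ proj₂ pairing ⟩
    Σ (λ x → ⟦ (- x) ≟ x ⟧ *ℤ nonzero-square x) +ℤ (k +ℤ k)   ≡⟨ cong (_+ℤ (k +ℤ k)) (trans (Σ-cong no-fixed-point) Σ-0) ⟩
    0ℤ +ℤ (k +ℤ k)                                            ≡⟨ ℤP.+-identityˡ (k +ℤ k) ⟩
    k +ℤ k                                                    ∎)
    where
    invariant : ∀ x → nonzero-square (- x) ≡ nonzero-square x
    invariant x = cong (λ c → ⟦ c ℤ.≟ 1ℤ ⟧) (trans (χ-neg x) (trans (cong (_*ℤ χ x) ε≡1) (ℤP.*-identityˡ (χ x))))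
    no-fixed-point : ∀ x → ⟦ (- x) ≟ x ⟧ *ℤ nonzero-square x ≡ 0ℤ
    no-fixed-point x with (- x) ≟ x
    ... | no _     = refl
    ... | yes -x≡x = trans (ℤP.*-identityˡ _) (cong (λ c → ⟦ c ℤ.≟ 1ℤ ⟧) (trans (cong χ (x≡-x⇒x≡0 (sym -x≡x))) χ-0))
    pairing = Σ-involution -_ ⁻¹-involutive (λ x → (- x) ≟ x) nonzero-square invariant
    k = proj₁ pairing

  -- x ↦ x⁻¹ pairs off the nonzero squares other than 1, since -1 is not a square.
  ε≡-1⇒odd : ε ≡ -1ℤ → Odd (+ h)
  ε≡-1⇒odd ε≡-1 = k , (begin
    + h
      ≡⟨ Σ-nonzero-square ⟨
    Σ nonzero-square
      ≡⟨ proj₂ pairing ⟩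
    Σ (λ x → ⟦ ι x ≟ x ⟧ *ℤ nonzero-square x) +ℤ (k +ℤ k)
      ≡⟨ cong (_+ℤ (k +ℤ k)) (trans (Σ-cong only-1) (Σ-indicator 1# (_≟ 1#))) ⟩
    1ℤ +ℤ (k +ℤ k)
      ∎)
    where
    invariant : ∀ x → nonzero-square (ι x) ≡ nonzero-square x
    invariant x = cong (λ c → ⟦ c ℤ.≟ 1ℤ ⟧) (χ-ι x)
    only-1 : ∀ x → ⟦ ι x ≟ x ⟧ *ℤ nonzero-square x ≡ ⟦ x ≟ 1# ⟧
    only-1 x with x ≟ 1#
    ... | yes refl = cong₂ _*ℤ_ (⟦⟧-yes ι-1 (ι 1# ≟ 1#)) (cong (λ c → ⟦ c ℤ.≟ 1ℤ ⟧) χ-1)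
    ... | no x≢1 with ι x ≟ x | χ x ℤ.≟ 1ℤ
    ...   | no _    | _        = refl
    ...   | yes _   | no _     = refl
    ...   | yes ιx≡x | yes χx≡1 = ⊥-elim ([ x≢1 , x≢-1 ]′ (square-roots x²≡1))
      where
      x≢0 : x ≢ 0#
      x≢0 x≡0 with trans (sym χx≡1) (trans (cong χ x≡0) χ-0)
      ... | ()
      x²≡1 : x * x ≡ 1# * 1#
      x²≡1 = trans (cong (x *_) (sym ιx≡x)) (trans (ι-inverseʳ x≢0) (sym (*-identityˡ 1#)))
      x≢-1 : x ≢ - 1#
      x≢-1 x≡-1 with trans (sym χx≡1) (trans (cong χ x≡-1) ε≡-1)
      ... | ()
    pairing = Σ-involution ι ι-involutive (λ x → ι x ≟ x) nonzero-square invariant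
    k = proj₁ pairing

  ε-parity : (ε ≡ 1ℤ × Even (+ h)) ⊎ (ε ≡ -1ℤ × Odd (+ h))
  ε-parity with χ-unit (neg-≢0 1≢0)
  ... | inj₁ ε≡1  = inj₁ (ε≡1 , ε≡1⇒even ε≡1)
  ... | inj₂ ε≡-1 = inj₂ (ε≡-1 , ε≡-1⇒odd ε≡-1)

  τ : ℤ → Carrier → ℤ
  τ c y = 1ℤ -ℤ c *ℤ δ y

  corr-χτ : ∀ c a → corr χ (τ c) a ≡ ℤ.- (c *ℤ χ a)
  corr-χτ c a = begin
    corr χ (τ c) a                                   ≡⟨ corr-linearʳ χ (λ _ → 1ℤ) δ c a ⟩
    corr χ (λ _ → 1ℤ) a -ℤ c *ℤ corr χ δ a           ≡⟨ cong₂ (λ u v → u -ℤ c *ℤ v) (corr-χ1 a) (corr-χδ a) ⟩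
    0ℤ -ℤ c *ℤ χ a                                   ≡⟨ ℤP.+-identityˡ _ ⟩
    ℤ.- (c *ℤ χ a)                                   ∎

  corr-τχ : ∀ c a → corr (τ c) χ a ≡ ℤ.- (c *ℤ (ε *ℤ χ a))
  corr-τχ c a = begin
    corr (τ c) χ a                                   ≡⟨ corr-linearˡ (λ _ → 1ℤ) δ χ c a ⟩
    corr (λ _ → 1ℤ) χ a -ℤ c *ℤ corr δ χ a           ≡⟨ cong₂ (λ u v → u -ℤ c *ℤ v) (corr-1χ a) (corr-δχ a) ⟩
    0ℤ -ℤ c *ℤ (ε *ℤ χ a)                            ≡⟨ ℤP.+-identityˡ _ ⟩
    ℤ.- (c *ℤ (ε *ℤ χ a))                            ∎

  corr-ττ : ∀ c d a → corr (τ c) (τ d) a ≡ + q -ℤ c -ℤ d +ℤ c *ℤ d *ℤ δ a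
  corr-ττ c d a = begin
    corr (τ c) (τ d) a
      ≡⟨ corr-linearˡ (λ _ → 1ℤ) δ (τ d) c a ⟩
    corr (λ _ → 1ℤ) (τ d) a -ℤ c *ℤ corr δ (τ d) a
      ≡⟨ cong₂ (λ u v → u -ℤ c *ℤ v) (corr-linearʳ (λ _ → 1ℤ) (λ _ → 1ℤ) δ d a) (corr-linearʳ δ (λ _ → 1ℤ) δ d a) ⟩
    (corr (λ _ → 1ℤ) (λ _ → 1ℤ) a -ℤ d *ℤ corr (λ _ → 1ℤ) δ a) -ℤ c *ℤ (corr δ (λ _ → 1ℤ) a -ℤ d *ℤ corr δ δ a)
      ≡⟨ cong₂ (λ u v → u -ℤ c *ℤ v) (cong₂ (λ u v → u -ℤ d *ℤ v) (corr-11 a) (corr-1δ a))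
                                     (cong₂ (λ u v → u -ℤ d *ℤ v) (corr-δ1 a) (corr-δδ a)) ⟩
    (+ q -ℤ d *ℤ 1ℤ) -ℤ c *ℤ (1ℤ -ℤ d *ℤ δ a)
      ≡⟨ expand (+ q) c d (δ a) ⟩
    + q -ℤ c -ℤ d +ℤ c *ℤ d *ℤ δ a
      ∎
    where
    expand : ∀ q c d e → (q -ℤ d *ℤ 1ℤ) -ℤ c *ℤ (1ℤ -ℤ d *ℤ e) ≡ q -ℤ c -ℤ d +ℤ c *ℤ d *ℤ e
    expand = solve-∀

module SignedSubset (G : FiniteGroup) where

  open import Data.Integer using () renaming (_+_ to _+ℤ_; _*_ to _*ℤ_)
  open import Algebra.Bundles using (Group)
  open FiniteGroup G
  open GroupRing G

  group : Group _ _
  group = record { isGroup = isGroup }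

  open import Algebra.Properties.Group group using (⁻¹-involutive)
  open Group group using (identityʳ)

  ind≡⟦⟧ : ∀ {S : Carrier → Set} (S? : ∀ g → Dec (S g)) g → ind S? g ≡ ⟦ S? g ⟧
  ind≡⟦⟧ S? g with S? g
  ... | yes _ = refl
  ... | no _  = refl

  ·⁽⁻¹⁾-at-ε : ∀ D → (D · (D ⁽⁻¹⁾)) ε ≡ ΣG (λ h → D h *ℤ D h)
  ·⁽⁻¹⁾-at-ε D = sumFin-cong (λ i → cong (λ z → D (elt i) *ℤ D z) (inverse-of-inverse (elt i)))
    where
    inverse-of-inverse : ∀ h → ((h ⁻¹) ∙ ε) ⁻¹ ≡ h
    inverse-of-inverse h = trans (cong _⁻¹ (identityʳ (h ⁻¹))) (⁻¹-involutive h)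

  signed-weight : ∀ D → (∀ g → D g ≡ 1ℤ ⊎ D g ≡ 0ℤ ⊎ D g ≡ -1ℤ) →
                  card (λ g → D g ℤ.≟ 1ℤ) +ℤ card (λ g → D g ℤ.≟ -1ℤ) ≡ (D · (D ⁽⁻¹⁾)) ε
  signed-weight D D-values = begin
    card (λ g → D g ℤ.≟ 1ℤ) +ℤ card (λ g → D g ℤ.≟ -1ℤ)
      ≡⟨ sumFin-+ (ind (λ g → D g ℤ.≟ 1ℤ) ∘ elt) (ind (λ g → D g ℤ.≟ -1ℤ) ∘ elt) ⟨
    ΣG (λ g → ind (λ g → D g ℤ.≟ 1ℤ) g +ℤ ind (λ g → D g ℤ.≟ -1ℤ) g)
      ≡⟨ sumFin-cong (square ∘ elt) ⟩
    ΣG (λ h → D h *ℤ D h)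
      ≡⟨ ·⁽⁻¹⁾-at-ε D ⟨
    (D · (D ⁽⁻¹⁾)) ε
      ∎
    where
    open ≡-Reasoning
    square : ∀ g → ind (λ g → D g ℤ.≟ 1ℤ) g +ℤ ind (λ g → D g ℤ.≟ -1ℤ) g ≡ D g *ℤ D g
    square g rewrite ind≡⟦⟧ (λ g → D g ℤ.≟ 1ℤ) g | ind≡⟦⟧ (λ g → D g ℤ.≟ -1ℤ) g with D-values g
    ... | inj₁ Dg≡1        rewrite Dg≡1 = refl
    ... | inj₂ (inj₁ Dg≡0) rewrite Dg≡0 = refl
    ... | inj₂ (inj₂ Dg≡-1) rewrite Dg≡-1 = refl

module ProductGroup {q r : ℕ} (F : FiniteField q) (K : FiniteField r) where

  open import Data.Integer using () renaming (_+_ to _+ℤ_; _*_ to _*ℤ_)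
  open ≡-Reasoning
  open GroupRing (AddGroup⊕ F K)
  open FiniteGroup (AddGroup⊕ F K) using (ΣG; _≟_; ε)
  module F = FiniteFieldProperties F
  module K = FiniteFieldProperties K

  ΣG-split : ∀ f → ΣG f ≡ F.Σ (λ x → K.Σ (λ y → f (x , y)))
  ΣG-split f = sumFin-remQuot q r (λ ij → f (F.elt (proj₁ ij) , K.elt (proj₂ ij)))

  _⊗_ : (F.Carrier → ℤ) → (K.Carrier → ℤ) → ℤ[G]
  (a ⊗ b) (x , y) = a x *ℤ b y

  Σ⊗ : ∀ {m} → (Fin m → F.Carrier → ℤ) → (Fin m → K.Carrier → ℤ) → ℤ[G]
  Σ⊗ {m} a b g = sumFin m (λ i → (a i ⊗ b i) g)

  corr-Σ⊗ : ∀ {m n} (a : Fin m → F.Carrier → ℤ) (b : Fin m → K.Carrier → ℤ)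
                    (a′ : Fin n → F.Carrier → ℤ) (b′ : Fin n → K.Carrier → ℤ) x₀ y₀ →
            (Σ⊗ a b · (Σ⊗ a′ b′ ⁽⁻¹⁾)) (x₀ , y₀) ≡
            sumFin m (λ i → sumFin n (λ j → F.corr (a i) (a′ j) x₀ *ℤ K.corr (b i) (b′ j) y₀))
  corr-Σ⊗ {m} {n} a b a′ b′ x₀ y₀ = begin
    ΣG (λ h → Σ⊗ a b h *ℤ Σ⊗ a′ b′ (proj₁ h F.⊖ x₀ , proj₂ h K.⊖ y₀))
      ≡⟨ ΣG-split (λ h → Σ⊗ a b h *ℤ Σ⊗ a′ b′ (proj₁ h F.⊖ x₀ , proj₂ h K.⊖ y₀)) ⟩
    F.Σ (λ x → K.Σ (λ y → Σ⊗ a b (x , y) *ℤ Σ⊗ a′ b′ (x F.⊖ x₀ , y K.⊖ y₀)))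
      ≡⟨ F.Σ-cong (λ x → K.Σ-cong (λ y → expand x y)) ⟩
    F.Σ (λ x → K.Σ (λ y → sumFin m (λ i → sumFin n (λ j → A i j x *ℤ B i j y))))
      ≡⟨ F.Σ-cong (λ x → trans (K.Σ-sumFin m (λ i y → sumFin n (λ j → A i j x *ℤ B i j y)))
                                (sumFin-cong (λ i → K.Σ-sumFin n (λ j y → A i j x *ℤ B i j y)))) ⟩
    F.Σ (λ x → sumFin m (λ i → sumFin n (λ j → K.Σ (λ y → A i j x *ℤ B i j y))))
      ≡⟨ F.Σ-cong (λ x → sumFin-cong (λ i → sumFin-cong (λ j → K.Σ-*ˡ (A i j x) (B i j)))) ⟩
    F.Σ (λ x → sumFin m (λ i → sumFin n (λ j → A i j x *ℤ K.corr (b i) (b′ j) y₀)))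
      ≡⟨ trans (F.Σ-sumFin m (λ i x → sumFin n (λ j → A i j x *ℤ K.corr (b i) (b′ j) y₀)))
               (sumFin-cong (λ i → F.Σ-sumFin n (λ j x → A i j x *ℤ K.corr (b i) (b′ j) y₀))) ⟩
    sumFin m (λ i → sumFin n (λ j → F.Σ (λ x → A i j x *ℤ K.corr (b i) (b′ j) y₀)))
      ≡⟨ sumFin-cong (λ i → sumFin-cong (λ j → F.Σ-*ʳ (A i j) (K.corr (b i) (b′ j) y₀))) ⟩
    sumFin m (λ i → sumFin n (λ j → F.corr (a i) (a′ j) x₀ *ℤ K.corr (b i) (b′ j) y₀))
      ∎
    where
    A : Fin m → Fin n → F.Carrier → ℤ
    A i j x = a i x *ℤ a′ j (x F.⊖ x₀)
    B : Fin m → Fin n → K.Carrier → ℤ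
    B i j y = b i y *ℤ b′ j (y K.⊖ y₀)
    interchange : ∀ u v u′ v′ → (u *ℤ v) *ℤ (u′ *ℤ v′) ≡ (u *ℤ u′) *ℤ (v *ℤ v′)
    interchange = solve-∀
    expand : ∀ x y → Σ⊗ a b (x , y) *ℤ Σ⊗ a′ b′ (x F.⊖ x₀ , y K.⊖ y₀) ≡
                     sumFin m (λ i → sumFin n (λ j → A i j x *ℤ B i j y))
    expand x y = trans (sumFin-*-sumFin m n (λ i → (a i ⊗ b i) (x , y)) (λ j → (a′ j ⊗ b′ j) (x F.⊖ x₀ , y K.⊖ y₀)))
      (sumFin-cong (λ i → sumFin-cong (λ j → interchange (a i x) (b i y) (a′ j (x F.⊖ x₀)) (b′ j (y K.⊖ y₀)))))

  one-⊕ : ∀ x y → one (x , y) ≡ F.δ x *ℤ K.δ y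
  one-⊕ x y with (x , y) ≟ ε | x F.≟ F.0# | y K.≟ K.0#
  ... | yes _     | yes _    | yes _    = refl
  ... | yes refl  | no x≢0   | _        = ⊥-elim (x≢0 refl)
  ... | yes refl  | yes _    | no y≢0   = ⊥-elim (y≢0 refl)
  ... | no xy≢0   | yes refl | yes refl = ⊥-elim (xy≢0 refl)
  ... | no _      | yes _    | no _     = refl
  ... | no _      | no _     | _        = refl

module SignedDifferenceSet {h q r : ℕ} (q≡1+2h : q ≡ suc (h ℕ.+ h)) (r≡q+6 : r ≡ q ℕ.+ 6)
                           (F : FiniteField q) (K : FiniteField r) where

  open import Data.Integer using () renaming (_+_ to _+ℤ_; _*_ to _*ℤ_; _-_ to _-ℤ_)
  open ≡-Reasoning

  r≡1+2[h+3] : r ≡ suc ((h ℕ.+ 3) ℕ.+ (h ℕ.+ 3))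
  r≡1+2[h+3] = trans r≡q+6 (trans (cong (ℕ._+ 6) q≡1+2h) (regroup h))
    where
    open import Data.Nat.Tactic.RingSolver using () renaming (solve-∀ to ℕ-solve-∀)
    regroup : ∀ h → suc (h ℕ.+ h) ℕ.+ 6 ≡ suc ((h ℕ.+ 3) ℕ.+ (h ℕ.+ 3))
    regroup = ℕ-solve-∀

  module F = QuadraticCharacter {h = h} F q≡1+2h
  module K = QuadraticCharacter {h = h ℕ.+ 3} K r≡1+2[h+3]
  open GroupRing (AddGroup⊕ F K)
  open ProductGroup F K using (Σ⊗; corr-Σ⊗; one-⊕)
  open SignedSubset (AddGroup⊕ F K) using (ind≡⟦⟧; signed-weight)

  D : ℤ[G]
  D = D-PN F K

  P∩N≡∅ : ∀ g → InN F K g → ¬ InP F K g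
  P∩N≡∅ _ refl (inj₁ χ0χ0≡1) with trans (sym (cong₂ _*ℤ_ F.χ-0 K.χ-0)) χ0χ0≡1
  ... | ()
  P∩N≡∅ _ refl (inj₂ (_ , 0≢0)) = 0≢0 refl

  D-values : ∀ g → D g ≡ 1ℤ ⊎ D g ≡ 0ℤ ⊎ D g ≡ -1ℤ
  D-values g rewrite ind≡⟦⟧ (InP? F K) g | ind≡⟦⟧ (InN? F K) g with InP? F K g | InN? F K g
  ... | yes p | yes n = ⊥-elim (P∩N≡∅ g n p)
  ... | yes _ | no _  = inj₁ refl
  ... | no _  | no _  = inj₂ (inj₁ refl)
  ... | no _  | yes _ = inj₂ (inj₂ refl)

  a : Fin 3 → F.Carrier → ℤ
  a zero             = F.χ
  a (suc zero)       = λ _ → 1ℤ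
  a (suc (suc zero)) = F.δ

  b : Fin 3 → K.Carrier → ℤ
  b zero             = K.χ
  b (suc zero)       = K.τ 1ℤ
  b (suc (suc zero)) = K.τ (+ 3)

  Σ⊗ab : ∀ x y → Σ⊗ a b (x , y) ≡ F.χ x *ℤ K.χ y +ℤ (1ℤ -ℤ K.δ y) +ℤ F.δ x *ℤ (1ℤ -ℤ + 3 *ℤ K.δ y)
  Σ⊗ab x y = simplify (F.χ x) (K.χ y) (F.δ x) (K.δ y)
    where
    simplify : ∀ cx cy dx dy → cx *ℤ cy +ℤ (1ℤ *ℤ (1ℤ -ℤ 1ℤ *ℤ dy) +ℤ (dx *ℤ (1ℤ -ℤ + 3 *ℤ dy) +ℤ 0ℤ))
                               ≡ cx *ℤ cy +ℤ (1ℤ -ℤ dy) +ℤ dx *ℤ (1ℤ -ℤ + 3 *ℤ dy)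
    simplify = solve-∀

  twice-D : ∀ g → + 2 *ℤ D g ≡ Σ⊗ a b g
  twice-D (x , y) = by-cases (x F.≟ F.0#) (y K.≟ K.0#)
    where
    P? = InP? F K (x , y)
    N? = InN? F K (x , y)
    from-values : ∀ {p n cx cy dx dy} → ⟦ P? ⟧ ≡ p → ⟦ N? ⟧ ≡ n →
                  F.χ x ≡ cx → K.χ y ≡ cy → F.δ x ≡ dx → K.δ y ≡ dy →
                  + 2 *ℤ (p -ℤ n) ≡ cx *ℤ cy +ℤ (1ℤ -ℤ dy) +ℤ dx *ℤ (1ℤ -ℤ + 3 *ℤ dy) →
                  + 2 *ℤ D (x , y) ≡ Σ⊗ a b (x , y)
    from-values refl refl refl refl refl refl e =
      trans (cong (λ d → + 2 *ℤ d) (cong₂ _-ℤ_ (ind≡⟦⟧ (InP? F K) (x , y)) (ind≡⟦⟧ (InN? F K) (x , y))))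
            (trans e (sym (Σ⊗ab x y)))
    off-axis : ∀ {cx cy} → x ≢ F.0# → F.χ x ≡ cx → K.χ y ≡ cy → ⟦ P? ⟧ ≡ ⟦ cx ℤ.* cy ℤ.≟ 1ℤ ⟧
    off-axis x≢0 refl refl =
      ⟦⟧-cong [ (λ e → e) , (λ { (x≡0 , _) → ⊥-elim (x≢0 x≡0) }) ]′ inj₁ P? (F.χ x ℤ.* K.χ y ℤ.≟ 1ℤ)
    off-x-axis : ∀ {cx cy dy} → x ≢ F.0# → F.χ x ≡ cx → K.χ y ≡ cy → K.δ y ≡ dy →
                 + 2 *ℤ (⟦ cx ℤ.* cy ℤ.≟ 1ℤ ⟧ -ℤ 0ℤ) ≡ cx *ℤ cy +ℤ (1ℤ -ℤ dy) +ℤ 0ℤ *ℤ (1ℤ -ℤ + 3 *ℤ dy) →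
                 + 2 *ℤ D (x , y) ≡ Σ⊗ a b (x , y)
    off-x-axis x≢0 χx χy δy =
      from-values (off-axis x≢0 χx χy) (⟦⟧-no (x≢0 ∘ cong proj₁) N?) χx χy (F.δ-≢0 x≢0) δy
    by-cases : Dec (x ≡ F.0#) → Dec (y ≡ K.0#) → + 2 *ℤ D (x , y) ≡ Σ⊗ a b (x , y)
    by-cases (yes refl) (yes refl) =
      from-values (⟦⟧-no (P∩N≡∅ (x , y) refl) P?) (⟦⟧-yes refl N?) F.χ-0 K.χ-0 F.δ-0 K.δ-0 refl
    by-cases (yes refl) (no y≢0) =
      from-values (⟦⟧-yes (inj₂ (refl , y≢0)) P?) (⟦⟧-no (y≢0 ∘ cong proj₂) N?) F.χ-0 refl F.δ-0 (K.δ-≢0 y≢0) refl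
    by-cases (no x≢0) (yes refl) with F.χ-unit x≢0
    ... | inj₁ χx≡1  = off-x-axis x≢0 χx≡1  K.χ-0 K.δ-0 refl
    ... | inj₂ χx≡-1 = off-x-axis x≢0 χx≡-1 K.χ-0 K.δ-0 refl
    by-cases (no x≢0) (no y≢0) with F.χ-unit x≢0 | K.χ-unit y≢0
    ... | inj₁ χx≡1  | inj₁ χy≡1  = off-x-axis x≢0 χx≡1  χy≡1  (K.δ-≢0 y≢0) refl
    ... | inj₁ χx≡1  | inj₂ χy≡-1 = off-x-axis x≢0 χx≡1  χy≡-1 (K.δ-≢0 y≢0) refl
    ... | inj₂ χx≡-1 | inj₁ χy≡1  = off-x-axis x≢0 χx≡-1 χy≡1  (K.δ-≢0 y≢0) refl
    ... | inj₂ χx≡-1 | inj₂ χy≡-1 = off-x-axis x≢0 χx≡-1 χy≡-1 (K.δ-≢0 y≢0) refl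

  -- (q - 1)/2 and (r - 1)/2 differ by 3, so exactly one of χ_F(-1), χ_K(-1) is -1.
  ε-product : F.ε *ℤ K.ε ≡ -1ℤ
  ε-product with F.ε-parity | K.ε-parity
  ... | inj₁ (εF≡1 , _)    | inj₂ (εK≡-1 , _)   = cong₂ _*ℤ_ εF≡1 εK≡-1
  ... | inj₂ (εF≡-1 , _)   | inj₁ (εK≡1 , _)    = cong₂ _*ℤ_ εF≡-1 εK≡1
  ... | inj₁ (_ , h-even)  | inj₁ (_ , h+3-even) =
    ⊥-elim (even⇒¬odd h+3-even (subst Odd (sym (ℤP.pos-+ h 3)) (even+3 h-even)))
  ... | inj₂ (_ , h-odd)   | inj₂ (_ , h+3-odd)  =
    ⊥-elim (even⇒¬odd (subst Even (sym (ℤP.pos-+ h 3)) (odd+3 h-odd)) h+3-odd)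

  Γ-F : Fin 3 → Fin 3 → F.Carrier → ℤ
  Γ-F zero             zero             x₀ = + q *ℤ F.δ x₀ -ℤ 1ℤ
  Γ-F zero             (suc zero)       x₀ = 0ℤ
  Γ-F zero             (suc (suc zero)) x₀ = F.χ x₀
  Γ-F (suc zero)       zero             x₀ = 0ℤ
  Γ-F (suc zero)       (suc zero)       x₀ = + q
  Γ-F (suc zero)       (suc (suc zero)) x₀ = 1ℤ
  Γ-F (suc (suc zero)) zero             x₀ = F.ε *ℤ F.χ x₀
  Γ-F (suc (suc zero)) (suc zero)       x₀ = 1ℤ
  Γ-F (suc (suc zero)) (suc (suc zero)) x₀ = F.δ x₀

  corr-a : ∀ i j x₀ → F.corr (a i) (a j) x₀ ≡ Γ-F i j x₀
  corr-a zero             zero             = F.corr-χχ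
  corr-a zero             (suc zero)       = F.corr-χ1
  corr-a zero             (suc (suc zero)) = F.corr-χδ
  corr-a (suc zero)       zero             = F.corr-1χ
  corr-a (suc zero)       (suc zero)       = F.corr-11
  corr-a (suc zero)       (suc (suc zero)) = F.corr-1δ
  corr-a (suc (suc zero)) zero             = F.corr-δχ
  corr-a (suc (suc zero)) (suc zero)       = F.corr-δ1
  corr-a (suc (suc zero)) (suc (suc zero)) = F.corr-δδ

  Γ-K : Fin 3 → Fin 3 → K.Carrier → ℤ
  Γ-K zero             zero             y₀ = + r *ℤ K.δ y₀ -ℤ 1ℤ
  Γ-K zero             (suc zero)       y₀ = ℤ.- (1ℤ *ℤ K.χ y₀)
  Γ-K zero             (suc (suc zero)) y₀ = ℤ.- (+ 3 *ℤ K.χ y₀)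
  Γ-K (suc zero)       zero             y₀ = ℤ.- (1ℤ *ℤ (K.ε *ℤ K.χ y₀))
  Γ-K (suc zero)       (suc zero)       y₀ = + r -ℤ 1ℤ -ℤ 1ℤ +ℤ 1ℤ *ℤ 1ℤ *ℤ K.δ y₀
  Γ-K (suc zero)       (suc (suc zero)) y₀ = + r -ℤ 1ℤ -ℤ + 3 +ℤ 1ℤ *ℤ + 3 *ℤ K.δ y₀
  Γ-K (suc (suc zero)) zero             y₀ = ℤ.- (+ 3 *ℤ (K.ε *ℤ K.χ y₀))
  Γ-K (suc (suc zero)) (suc zero)       y₀ = + r -ℤ + 3 -ℤ 1ℤ +ℤ + 3 *ℤ 1ℤ *ℤ K.δ y₀
  Γ-K (suc (suc zero)) (suc (suc zero)) y₀ = + r -ℤ + 3 -ℤ + 3 +ℤ + 3 *ℤ + 3 *ℤ K.δ y₀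

  corr-b : ∀ i j y₀ → K.corr (b i) (b j) y₀ ≡ Γ-K i j y₀
  corr-b zero             zero             = K.corr-χχ
  corr-b zero             (suc zero)       = K.corr-χτ 1ℤ
  corr-b zero             (suc (suc zero)) = K.corr-χτ (+ 3)
  corr-b (suc zero)       zero             = K.corr-τχ 1ℤ
  corr-b (suc zero)       (suc zero)       = K.corr-ττ 1ℤ 1ℤ
  corr-b (suc zero)       (suc (suc zero)) = K.corr-ττ 1ℤ (+ 3)
  corr-b (suc (suc zero)) zero             = K.corr-τχ (+ 3)
  corr-b (suc (suc zero)) (suc zero)       = K.corr-ττ (+ 3) 1ℤ
  corr-b (suc (suc zero)) (suc (suc zero)) = K.corr-ττ (+ 3) (+ 3)

  -- The nine products Γ-F i j · Γ-K i j, in the order in which the double sum lists them.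
  table-identity : ∀ Q R d₁ d₂ c₁ c₂ e₁ e₂ →
      ((Q *ℤ d₁ -ℤ 1ℤ) *ℤ (R *ℤ d₂ -ℤ 1ℤ) +ℤ (0ℤ *ℤ ℤ.- (1ℤ *ℤ c₂) +ℤ (c₁ *ℤ ℤ.- (+ 3 *ℤ c₂) +ℤ 0ℤ)))
      +ℤ ((0ℤ *ℤ ℤ.- (1ℤ *ℤ (e₂ *ℤ c₂)) +ℤ (Q *ℤ (R -ℤ 1ℤ -ℤ 1ℤ +ℤ 1ℤ *ℤ 1ℤ *ℤ d₂)
                                         +ℤ (1ℤ *ℤ (R -ℤ 1ℤ -ℤ + 3 +ℤ 1ℤ *ℤ + 3 *ℤ d₂) +ℤ 0ℤ)))
      +ℤ (((e₁ *ℤ c₁) *ℤ ℤ.- (+ 3 *ℤ (e₂ *ℤ c₂)) +ℤ (1ℤ *ℤ (R -ℤ + 3 -ℤ 1ℤ +ℤ + 3 *ℤ 1ℤ *ℤ d₂)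
                                                   +ℤ (d₁ *ℤ (R -ℤ + 3 -ℤ + 3 +ℤ + 3 *ℤ + 3 *ℤ d₂) +ℤ 0ℤ)))
      +ℤ 0ℤ))
      ≡ (Q *ℤ R +ℤ + 9) *ℤ (d₁ *ℤ d₂) +ℤ (R -ℤ Q -ℤ + 6) *ℤ (d₁ -ℤ d₂) +ℤ (Q *ℤ R -ℤ + 2 *ℤ Q +ℤ + 2 *ℤ R -ℤ + 7)
        -ℤ + 3 *ℤ (c₁ *ℤ c₂) *ℤ (1ℤ +ℤ e₁ *ℤ e₂)
  table-identity = solve-∀

  n : ℕ
  n = (h ℕ.+ 2) ℕ.* (h ℕ.+ 2)

  +q≡ : + q ≡ 1ℤ +ℤ (+ h +ℤ + h)
  +q≡ = trans (cong +_ q≡1+2h) (trans (ℤP.pos-+ 1 (h ℕ.+ h)) (cong (1ℤ +ℤ_) (ℤP.pos-+ h h)))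

  +r≡ : + r ≡ + q +ℤ + 6
  +r≡ = trans (cong +_ r≡q+6) (ℤP.pos-+ q 6)

  +n≡ : + n ≡ (+ h +ℤ + 2) *ℤ (+ h +ℤ + 2)
  +n≡ = trans (ℤP.pos-* (h ℕ.+ 2) (h ℕ.+ 2)) (cong₂ _*ℤ_ (ℤP.pos-+ h 2) (ℤP.pos-+ h 2))

  order : + (q ℕ.* r) ≡ + 4 *ℤ + n -ℤ + 9
  order = begin
    + (q ℕ.* r)                                             ≡⟨ ℤP.pos-* q r ⟩
    + q *ℤ + r                                              ≡⟨ cong (+ q *ℤ_) +r≡ ⟩
    + q *ℤ (+ q +ℤ + 6)                                     ≡⟨ cong (λ Q → Q *ℤ (Q +ℤ + 6)) +q≡ ⟩
    (1ℤ +ℤ (+ h +ℤ + h)) *ℤ ((1ℤ +ℤ (+ h +ℤ + h)) +ℤ + 6)   ≡⟨ expand (+ h) ⟩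
    + 4 *ℤ ((+ h +ℤ + 2) *ℤ (+ h +ℤ + 2)) -ℤ + 9            ≡⟨ cong (λ N → + 4 *ℤ N -ℤ + 9) +n≡ ⟨
    + 4 *ℤ + n -ℤ + 9                                       ∎
    where
    expand : ∀ κ → (1ℤ +ℤ (κ +ℤ κ)) *ℤ ((1ℤ +ℤ (κ +ℤ κ)) +ℤ + 6) ≡ + 4 *ℤ ((κ +ℤ + 2) *ℤ (κ +ℤ + 2)) -ℤ + 9
    expand = solve-∀

  k lam : ℤ
  k = + 2 *ℤ + n -ℤ + 1
  lam = + n -ℤ + 1

  autocorrelation : ∀ g → (D · (D ⁽⁻¹⁾)) g ≡ (((k -ℤ lam) ⊛ one) ⊕ (lam ⊛ all)) g
  autocorrelation (x₀ , y₀) = ℤP.*-cancelˡ-≡ (+ 4) _ _ (begin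
    + 4 *ℤ (D · (D ⁽⁻¹⁾)) (x₀ , y₀)
      ≡⟨ quadruple ⟩
    (Σ⊗ a b · (Σ⊗ a b ⁽⁻¹⁾)) (x₀ , y₀)
      ≡⟨ corr-Σ⊗ a b a b x₀ y₀ ⟩
    sumFin 3 (λ i → sumFin 3 (λ j → F.corr (a i) (a j) x₀ *ℤ K.corr (b i) (b j) y₀))
      ≡⟨ sumFin-cong (λ i → sumFin-cong (λ j → cong₂ _*ℤ_ (corr-a i j x₀) (corr-b i j y₀))) ⟩
    sumFin 3 (λ i → sumFin 3 (λ j → Γ-F i j x₀ *ℤ Γ-K i j y₀))
      ≡⟨ table-identity (+ q) (+ r) (F.δ x₀) (K.δ y₀) (F.χ x₀) (K.χ y₀) F.ε K.ε ⟩
    P (+ q) (+ r) -ℤ + 3 *ℤ (F.χ x₀ *ℤ K.χ y₀) *ℤ (1ℤ +ℤ F.ε *ℤ K.ε)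
      ≡⟨ cong (λ e → P (+ q) (+ r) -ℤ + 3 *ℤ (F.χ x₀ *ℤ K.χ y₀) *ℤ (1ℤ +ℤ e)) ε-product ⟩
    P (+ q) (+ r) -ℤ + 3 *ℤ (F.χ x₀ *ℤ K.χ y₀) *ℤ 0ℤ
      ≡⟨ cong (λ R → P (+ q) R -ℤ + 3 *ℤ (F.χ x₀ *ℤ K.χ y₀) *ℤ 0ℤ) +r≡ ⟩
    P (+ q) (+ q +ℤ + 6) -ℤ + 3 *ℤ (F.χ x₀ *ℤ K.χ y₀) *ℤ 0ℤ
      ≡⟨ cong (λ Q → P Q (Q +ℤ + 6) -ℤ + 3 *ℤ (F.χ x₀ *ℤ K.χ y₀) *ℤ 0ℤ) +q≡ ⟩
    P (1ℤ +ℤ (+ h +ℤ + h)) ((1ℤ +ℤ (+ h +ℤ + h)) +ℤ + 6) -ℤ + 3 *ℤ (F.χ x₀ *ℤ K.χ y₀) *ℤ 0ℤ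
      ≡⟨ evaluate (+ h) (F.δ x₀) (K.δ y₀) (F.χ x₀ *ℤ K.χ y₀) ⟩
    + 4 *ℤ ((+ 2 *ℤ N -ℤ + 1 -ℤ (N -ℤ + 1)) *ℤ (F.δ x₀ *ℤ K.δ y₀) +ℤ (N -ℤ + 1) *ℤ 1ℤ)
      ≡⟨ cong₂ (λ N o → + 4 *ℤ ((+ 2 *ℤ N -ℤ + 1 -ℤ (N -ℤ + 1)) *ℤ o +ℤ (N -ℤ + 1) *ℤ 1ℤ)) +n≡ (one-⊕ x₀ y₀) ⟨
    + 4 *ℤ ((k -ℤ lam) *ℤ one (x₀ , y₀) +ℤ lam *ℤ 1ℤ)
      ∎)
    where
    P : ℤ → ℤ → ℤ
    P Q R = (Q *ℤ R +ℤ + 9) *ℤ (F.δ x₀ *ℤ K.δ y₀) +ℤ (R -ℤ Q -ℤ + 6) *ℤ (F.δ x₀ -ℤ K.δ y₀)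
            +ℤ (Q *ℤ R -ℤ + 2 *ℤ Q +ℤ + 2 *ℤ R -ℤ + 7)
    N = (+ h +ℤ + 2) *ℤ (+ h +ℤ + 2)
    evaluate : ∀ κ d₁ d₂ u →
      ((1ℤ +ℤ (κ +ℤ κ)) *ℤ ((1ℤ +ℤ (κ +ℤ κ)) +ℤ + 6) +ℤ + 9) *ℤ (d₁ *ℤ d₂)
      +ℤ (((1ℤ +ℤ (κ +ℤ κ)) +ℤ + 6) -ℤ (1ℤ +ℤ (κ +ℤ κ)) -ℤ + 6) *ℤ (d₁ -ℤ d₂)
      +ℤ ((1ℤ +ℤ (κ +ℤ κ)) *ℤ ((1ℤ +ℤ (κ +ℤ κ)) +ℤ + 6) -ℤ + 2 *ℤ (1ℤ +ℤ (κ +ℤ κ))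
          +ℤ + 2 *ℤ ((1ℤ +ℤ (κ +ℤ κ)) +ℤ + 6) -ℤ + 7)
      -ℤ + 3 *ℤ u *ℤ 0ℤ
      ≡ + 4 *ℤ ((+ 2 *ℤ ((κ +ℤ + 2) *ℤ (κ +ℤ + 2)) -ℤ + 1 -ℤ ((κ +ℤ + 2) *ℤ (κ +ℤ + 2) -ℤ + 1)) *ℤ (d₁ *ℤ d₂)
                +ℤ ((κ +ℤ + 2) *ℤ (κ +ℤ + 2) -ℤ + 1) *ℤ 1ℤ)
    evaluate = solve-∀
    quadruple : + 4 *ℤ (D · (D ⁽⁻¹⁾)) (x₀ , y₀) ≡ (Σ⊗ a b · (Σ⊗ a b ⁽⁻¹⁾)) (x₀ , y₀)
    quadruple = trans (sym (sumFin-*ˡ (+ 4) (λ i → D (G.elt i) *ℤ D (shifted (G.elt i)))))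
                      (sumFin-cong (λ i → pointwise (G.elt i) (shifted (G.elt i))))
      where
      module G = FiniteGroup (AddGroup⊕ F K)
      shifted : G.Carrier → G.Carrier
      shifted h = ((h G.⁻¹) G.∙ (x₀ , y₀)) G.⁻¹
      distribute : ∀ u v → + 4 *ℤ (u *ℤ v) ≡ (+ 2 *ℤ u) *ℤ (+ 2 *ℤ v)
      distribute = solve-∀
      pointwise : ∀ g h → + 4 *ℤ (D g *ℤ D h) ≡ Σ⊗ a b g *ℤ Σ⊗ a b h
      pointwise g h = trans (distribute (D g) (D h)) (cong₂ _*ℤ_ (twice-D g) (twice-D h))

  weight : k ≡ card (λ g → D g ℤ.≟ 1ℤ) +ℤ card (λ g → D g ℤ.≟ -1ℤ)
  weight = sym (begin
    card (λ g → D g ℤ.≟ 1ℤ) +ℤ card (λ g → D g ℤ.≟ -1ℤ)   ≡⟨ signed-weight D D-values ⟩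
    (D · (D ⁽⁻¹⁾)) (F.0# , K.0#)                          ≡⟨ autocorrelation (F.0# , K.0#) ⟩
    (k -ℤ lam) *ℤ one (F.0# , K.0#) +ℤ lam *ℤ 1ℤ         ≡⟨ cong (λ o → (k -ℤ lam) *ℤ o +ℤ lam *ℤ 1ℤ)
                                                               (trans (one-⊕ F.0# K.0#) (cong₂ _*ℤ_ F.δ-0 K.δ-0)) ⟩
    (k -ℤ lam) *ℤ 1ℤ +ℤ lam *ℤ 1ℤ                        ≡⟨ cancel k lam ⟩
    k                                                     ∎)
    where
    cancel : ∀ x y → (x -ℤ y) *ℤ 1ℤ +ℤ y *ℤ 1ℤ ≡ x
    cancel = solve-∀

half-odd : ∀ q m → q ℕ.+ 3 ≡ 2 ℕ.* m → ∃ λ h → q ≡ suc (h ℕ.+ h) × m ≡ h ℕ.+ 2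
half-odd q zero                q+3≡0 with trans (ℕP.+-comm 3 q) q+3≡0
... | ()
half-odd q (suc zero)          q+3≡2 with trans (ℕP.+-comm 3 q) q+3≡2
... | ()
half-odd q (suc (suc h)) q+3≡2m = h , ℕP.+-cancelʳ-≡ 3 q (suc (h ℕ.+ h)) (trans q+3≡2m (regroup h)) , ℕP.+-comm 2 h
  where
  open import Data.Nat.Tactic.RingSolver using () renaming (solve-∀ to ℕ-solve-∀)
  regroup : ∀ h → 2 ℕ.* suc (suc h) ≡ suc (h ℕ.+ h) ℕ.+ 3
  regroup = ℕ-solve-∀

theorem7 : (m q r : ℕ) → IsPrimePower q → IsPrimePower r →
           q ℕ.+ 3 ≡ 2 ℕ.* m → r ≡ q ℕ.+ 6 →
           (F : FiniteField q) (K : FiniteField r) →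
           GroupRing.IsSignedDifferenceSet (AddGroup⊕ F K)
             ((+ 4) ℤ.* (+ (m ℕ.* m)) ℤ.- (+ 9))
             ((+ 2) ℤ.* (+ (m ℕ.* m)) ℤ.- (+ 1))
             ((+ (m ℕ.* m)) ℤ.- (+ 1))
             (D-PN F K)
theorem7 m q r _ _ q+3≡2m r≡q+6 F K with half-odd q m q+3≡2m
... | h , q≡1+2h , refl = order , D-values , weight , autocorrelation
  where open SignedDifferenceSet {h = h} q≡1+2h r≡q+6 F K
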